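{- Let $k \geq 2$ be an integer, let $M$ be a $k$-connected binary matroid with at least $2(k-1)$ elements, and let $X$ be a non-empty independent set in $M$. Then the $\Gamma$-extension matroid $M^{X}$ is $k$-connected if and only if $|X| \geq k$ and $2 \leq k \leq 4$.
   Context: Let $M$ be a binary matroid with ground set $S$, represented over $GF(2)$ by a (standard) matrix $A$ whose columns are labeled by $S$. Let $X=\{x_1,\dots,x_m\}\subset S$ be a non-empty independent set of $M$ and let $\Gamma=\{\gamma_1,\dots,\gamma_m\}$ be a set disjoint from $S$. Let $A'$ be obtained from $A$ by adjoining $m$ new columns labeled $\gamma_1,\dots,\gamma_m$, where the column labeled $\gamma_i$ equals the column labeled $x_i$. Let $A^X$ be obtained from $A'$ by adjoining one extra row having entry $1$ in each column labeled $\gamma_i$ ($i=1,\dots,m$) and $0$ elsewhere. The $\Gamma$-extension $M^X$ of $M$ is the vector matroid of $A^X$ over $GF(2)$; its ground set is $S\cup\Gamma$. For an integer $j\ge 1$, a $j$-separation of a matroid $N$ with ground set $E$ and rank function $r$ is a partition of $E$ into disjoint sets $A,B$ with $\min\{|A|,|B|\}\ge j$ and $r(A)+r(B)-r(N)\le j-1$. A matroid is $k$-connected if it has no $j$-separation for any $j<k$. Throughout the paper all matroids are assumed loopless and coloopless. -}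

module Defs where

open import Data.Bool using (Bool; true; false; not; _∧_; _∨_; _xor_; if_then_else_; T)
open import Data.Nat using (ℕ; zero; suc; _+_; _≤_; _∸_; _⊔_)
open import Data.Fin using (Fin; zero; suc; splitAt)
open import Data.Sum using (inj₁; inj₂)
open import Data.List as List using (List; []; _∷_; _++_)
open import Data.Vec as Vec using (Vec; []; _∷_; _∷ʳ_)
open import Data.Fin.Subset using (Subset; ∁; ∣_∣; ⁅_⁆; _∪_; ⋃; ⊤)
open import Relation.Nullary using (¬_)

-- Columns of a GF(2)-matrix with r rows and n columns (labelled by Fin n).
-- GF(2) is represented by Bool, with addition = xor.
Matrix : ℕ → ℕ → Set
Matrix r n = Fin n → Vec Bool r

allSubsets : ∀ n → List (Subset n)
allSubsets zero = [] ∷ []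
allSubsets (suc n) = List.map (true ∷_) (allSubsets n) ++ List.map (false ∷_) (allSubsets n)

_⊆ᵇ_ : ∀ {n} → Subset n → Subset n → Bool
[] ⊆ᵇ [] = true
(a ∷ p) ⊆ᵇ (b ∷ q) = (not a ∨ b) ∧ (p ⊆ᵇ q)

nonemptyᵇ : ∀ {n} → Subset n → Bool
nonemptyᵇ [] = false
nonemptyᵇ (a ∷ p) = a ∨ nonemptyᵇ p

isZeroᵇ : ∀ {r} → Vec Bool r → Bool
isZeroᵇ [] = true
isZeroᵇ (a ∷ v) = not a ∧ isZeroᵇ v

sumCols : ∀ {r n} → Matrix r n → Subset n → Vec Bool r
sumCols {r} {zero} A [] = Vec.replicate r false
sumCols {r} {suc n} A (s ∷ p) =
  if s then Vec.zipWith _xor_ (A zero) (sumCols (λ i → A (suc i)) p)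
       else sumCols (λ i → A (suc i)) p

allᵇ : {A : Set} → (A → Bool) → List A → Bool
allᵇ p [] = true
allᵇ p (a ∷ as) = p a ∧ allᵇ p as

independentᵇ : ∀ {r n} → Matrix r n → Subset n → Bool
independentᵇ {r} {n} A U =
  allᵇ (λ V → not (V ⊆ᵇ U ∧ nonemptyᵇ V) ∨ not (isZeroᵇ (sumCols A V))) (allSubsets n)

Independent : ∀ {r n} → Matrix r n → Subset n → Set
Independent A U = T (independentᵇ A U)

rank : ∀ {r n} → Matrix r n → Subset n → ℕ
rank {r} {n} A Y =
  List.foldr _⊔_ 0
    (List.map (λ U → if (U ⊆ᵇ Y ∧ independentᵇ A U) then ∣ U ∣ else 0) (allSubsets n))

IsSeparation : ∀ {r n} → Matrix r n → ℕ → Subset n → Set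
IsSeparation A j P =
  (j ≤ ∣ P ∣) × (j ≤ ∣ ∁ P ∣) ×
  (rank A P + rank A (∁ P) ≤ rank A ⊤ + (j ∸ 1))
  where open import Data.Product using (_×_)

KConnected : ∀ {r n} → Matrix r n → ℕ → Set
KConnected {r} {n} A k = ∀ j → 1 ≤ j → suc j ≤ k → (P : Subset n) → ¬ IsSeparation A j P

image : ∀ {m n} → (Fin m → Fin n) → Subset n
image {m} x = ⋃ (List.map ⁅_⁆ (List.tabulate {n = m} x))

-- Γ-extension: columns 0..n-1 are S (old columns with a 0 appended in the
-- new last row), columns n..n+m-1 are γ_1..γ_m (copy of column x_i with a 1
-- in the new last row).
ΓExt : ∀ {r n m} → Matrix r n → (Fin m → Fin n) → Matrix (suc r) (n + m)
ΓExt {r} {n} A x j with splitAt n j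
... | inj₁ a = A a ∷ʳ false
... | inj₂ i = A (x i) ∷ʳ true

module Submission where

-- For N, a column sum has as top part a column sum of M
-- and as last entry the parity of the new elements used; this yields, for
-- a set Y = YS ∪ YG of N (YS old, YG new elements):
--   r_M(YS) ≤ r_N(Y), strictly if YG ≠ ∅;  |YG| ≤ r_N(Y);
--   r_N(Y) ≥ 3 if |YS| = 1, |YG| = 2 and M is 4-connected;  r(N) = r(M) + 1.
-- Sufficiency is then a counting argument on the numbers |YS|, |YG|,
-- r_M(YS), r_N(Y) of the two sides of a putative j-separation.  Necessity:
-- if m < k the new elements form an m-separation, and if k ≥ 5 the four
-- elements x γ, x γ′, γ, γ′ form a circuit, too small for k-connectivity.

open import Defs
open import Data.Bool using (Bool; true; false; not; _∧_; _∨_; _xor_; if_then_else_)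
import Data.Bool as Bool
open import Data.Bool.Properties using (xor-assoc; xor-comm; xor-same; xor-identityʳ; ∧-zeroʳ; T-≡)
open import Data.Empty using (⊥-elim)
open import Data.Fin as Fin using (Fin; zero; suc; _↑ˡ_; _↑ʳ_; splitAt)
open import Data.Fin.Properties using (any?; 0≢1+n; suc-injective; splitAt-↑ˡ; splitAt-↑ʳ)
open import Data.Fin.Subset using (Subset; ⊥; ⊤; ⁅_⁆; _∪_; _∈_; _∉_; _⊆_; ∣_∣; ∁; _-_)
open import Data.Fin.Subset.Properties
  using ( _∈?_; _⊆?_; nonempty?; anySubset?; Empty-unique; drop-there; drop-∷-⊆
        ; ∉⊥; ∈⊤; x∈⁅x⁆; x∈⁅y⁆⇒x≡y; x∈p∪q⁺; x∈p∪q⁻; x∉p⇒x∈∁p; x∈∁p⇒x∉p; x∉∁p⇒x∈p; x∈p∧x≢y⇒x∈p-y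
        ; ⊆-refl; ⊆-trans; ⊆-antisym; ⊆-min; ⊆-max; p⊆p∪q; q⊆p∪q; p─q⊆p; p─⊥≡p; ∪-identityʳ
        ; ∣⊥∣≡0; ∣⊤∣≡n; ∣⁅x⁆∣≡1; ∣p∣≤n; ∣p∣≤∣x∷p∣; ∣∁p∣≡n∸∣p∣; p⊆q⇒∣p∣≤∣q∣ )
open import Data.List as List using (List)
open import Data.List.Membership.Propositional using () renaming (_∈_ to _∈ˡ_)
open import Data.List.Membership.Propositional.Properties using (∈-++⁺ˡ; ∈-++⁺ʳ; ∈-map⁺)
import Data.List.Relation.Unary.Any as Any
open import Data.Nat using (ℕ; zero; suc; _+_; _*_; _≤_; _<_; _∸_; _⊔_; z≤n; s≤s; s≤s⁻¹; _≤?_; _≟_)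
open import Data.Nat.Properties hiding (suc-injective; 0≢1+n; _≟_)
import Data.Nat.Properties as ℕ
open import Data.Product using (Σ; _×_; _,_; proj₁; proj₂)
open import Data.Sum using (_⊎_; inj₁; inj₂)
open import Data.Vec as Vec using (Vec; []; _∷_; _∷ʳ_; _++_; replicate; zipWith; here; there)
open import Data.Vec.Properties
  using ( ≡-dec; ∷ʳ-injective; ++-injectiveˡ; ++-injectiveʳ; take++drop≡id; map-++
        ; zipWith-assoc; zipWith-comm; zipWith-identityˡ; zipWith-identityʳ )
open import Function.Bundles using (Equivalence; _⇔_; mk⇔)
open import Function.Definitions using (Injective)
open import Relation.Binary.PropositionalEquality
open import Relation.Nullary using (¬_; yes; no; Dec)
open import Relation.Nullary.Decidable using (_×-dec_)

infixl 6 _⊕_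

_⊕_ : ∀ {r} → Vec Bool r → Vec Bool r → Vec Bool r
_⊕_ = zipWith _xor_

0v : ∀ {r} → Vec Bool r
0v {r} = replicate r false

⊕-assoc : ∀ {r} (u v w : Vec Bool r) → (u ⊕ v) ⊕ w ≡ u ⊕ (v ⊕ w)
⊕-assoc = zipWith-assoc xor-assoc

⊕-comm : ∀ {r} (u v : Vec Bool r) → u ⊕ v ≡ v ⊕ u
⊕-comm = zipWith-comm xor-comm

⊕-identityˡ : ∀ {r} (u : Vec Bool r) → 0v ⊕ u ≡ u
⊕-identityˡ = zipWith-identityˡ (λ _ → refl)

⊕-identityʳ : ∀ {r} (u : Vec Bool r) → u ⊕ 0v ≡ u
⊕-identityʳ = zipWith-identityʳ xor-identityʳ

⊕-self : ∀ {r} (u : Vec Bool r) → u ⊕ u ≡ 0v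
⊕-self [] = refl
⊕-self (a ∷ u) = cong₂ _∷_ (xor-same a) (⊕-self u)

⊕-cancelˡ : ∀ {r} (u v : Vec Bool r) → u ⊕ (u ⊕ v) ≡ v
⊕-cancelˡ u v = begin
  u ⊕ (u ⊕ v) ≡⟨ ⊕-assoc u u v ⟨
  (u ⊕ u) ⊕ v ≡⟨ cong (_⊕ v) (⊕-self u) ⟩
  0v ⊕ v      ≡⟨ ⊕-identityˡ v ⟩
  v           ∎
  where open ≡-Reasoning

⊕≡0⇒≡ : ∀ {r} (u v : Vec Bool r) → u ⊕ v ≡ 0v → u ≡ v
⊕≡0⇒≡ u v eq = begin
  u            ≡⟨ ⊕-identityʳ u ⟨
  u ⊕ 0v       ≡⟨ cong (u ⊕_) eq ⟨
  u ⊕ (u ⊕ v)  ≡⟨ ⊕-cancelˡ u v ⟩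
  v            ∎
  where open ≡-Reasoning

⊕-exchange : ∀ {r} (a b c : Vec Bool r) → a ⊕ (b ⊕ c) ≡ b ⊕ (a ⊕ c)
⊕-exchange a b c = begin
  a ⊕ (b ⊕ c) ≡⟨ ⊕-assoc a b c ⟨
  (a ⊕ b) ⊕ c ≡⟨ cong (_⊕ c) (⊕-comm a b) ⟩
  (b ⊕ a) ⊕ c ≡⟨ ⊕-assoc b a c ⟩
  b ⊕ (a ⊕ c) ∎
  where open ≡-Reasoning

⊕-∷ʳ : ∀ {r} (u v : Vec Bool r) a b → (u ∷ʳ a) ⊕ (v ∷ʳ b) ≡ (u ⊕ v) ∷ʳ (a xor b)
⊕-∷ʳ [] [] a b = refl
⊕-∷ʳ (x ∷ u) (y ∷ v) a b = cong (_ ∷_) (⊕-∷ʳ u v a b)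

0v-∷ʳ : ∀ {r} → 0v {r} ∷ʳ false ≡ 0v
0v-∷ʳ {zero} = refl
0v-∷ʳ {suc r} = cong (false ∷_) (0v-∷ʳ {r})

_·_ : ∀ {r} → Bool → Vec Bool r → Vec Bool r
b · v = if b then v else 0v

-- A subset of Fin n is itself a Boolean vector, so ⊕ is symmetric
-- difference, ⊥ = 0v, and b · p is p or ⊥.

true≢false : true ≢ false
true≢false ()

parity : ∀ {n} → Subset n → Bool
parity [] = false
parity (b ∷ V) = b xor parity V

⊆-size-≡ : ∀ {n} {U Y : Subset n} → U ⊆ Y → ∣ Y ∣ ≤ ∣ U ∣ → U ≡ Y
⊆-size-≡ {U = []} {[]} _ _ = refl
⊆-size-≡ {U = true ∷ U} {true ∷ Y} s c = cong (true ∷_) (⊆-size-≡ (drop-∷-⊆ s) (s≤s⁻¹ c))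
⊆-size-≡ {U = false ∷ U} {false ∷ Y} s c = cong (false ∷_) (⊆-size-≡ (drop-∷-⊆ s) c)
⊆-size-≡ {U = false ∷ U} {true ∷ Y} s c = ⊥-elim (<-irrefl refl (≤-trans c (p⊆q⇒∣p∣≤∣q∣ (drop-∷-⊆ s))))
⊆-size-≡ {U = true ∷ U} {false ∷ Y} s c with s here
... | ()

∈-⊕⁻ : ∀ {n} (p q : Subset n) {x} → x ∈ p ⊕ q → (x ∈ p × x ∉ q) ⊎ (x ∉ p × x ∈ q)
∈-⊕⁻ (true ∷ p) (false ∷ q) here = inj₁ (here , λ ())
∈-⊕⁻ (false ∷ p) (true ∷ q) here = inj₂ ((λ ()) , here)
∈-⊕⁻ (a ∷ p) (b ∷ q) (there x∈) with ∈-⊕⁻ p q x∈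
... | inj₁ (x∈p , x∉q) = inj₁ (there x∈p , λ x∈ → x∉q (drop-there x∈))
... | inj₂ (x∉p , x∈q) = inj₂ ((λ x∈ → x∉p (drop-there x∈)) , there x∈q)

⊕-⊆ : ∀ {n} {p q u : Subset n} → p ⊆ u → q ⊆ u → p ⊕ q ⊆ u
⊕-⊆ {p = p} {q} p⊆u q⊆u x∈ with ∈-⊕⁻ p q x∈
... | inj₁ (x∈p , _) = p⊆u x∈p
... | inj₂ (_ , x∈q) = q⊆u x∈q

·-⊆ : ∀ {n} b {p u : Subset n} → p ⊆ u → b · p ⊆ u
·-⊆ true p⊆u = p⊆u
·-⊆ false {u = u} _ = ⊆-min u

⊆-tail : ∀ {n} {p q : Subset (suc n)} → p ⊆ q → Vec.tail p ⊆ Vec.tail q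
⊆-tail {p = a ∷ p} {b ∷ q} = drop-∷-⊆

∈-⊕⁺ˡ : ∀ {n} (p q : Subset n) {x} → x ∈ p → x ∉ q → x ∈ p ⊕ q
∈-⊕⁺ˡ (true ∷ p) (false ∷ q) here _ = here
∈-⊕⁺ˡ (true ∷ p) (true ∷ q) here x∉q = ⊥-elim (x∉q here)
∈-⊕⁺ˡ (a ∷ p) (b ∷ q) (there x∈p) x∉q = there (∈-⊕⁺ˡ p q x∈p (λ x∈q → x∉q (there x∈q)))

∈-⊕⁺ʳ : ∀ {n} (p q : Subset n) {x} → x ∉ p → x ∈ q → x ∈ p ⊕ q
∈-⊕⁺ʳ p q x∉p x∈q = subst (_ ∈_) (⊕-comm q p) (∈-⊕⁺ˡ q p x∈q x∉p)

⁅⁆-⊆ : ∀ {n} {x : Fin n} {p} → x ∈ p → ⁅ x ⁆ ⊆ p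
⁅⁆-⊆ {x = x} x∈p y∈ = subst (_∈ _) (sym (x∈⁅y⁆⇒x≡y x y∈)) x∈p

x∉p-x : ∀ {n} (p : Subset n) x → x ∉ p - x
x∉p-x (a ∷ p) zero ()
x∉p-x (a ∷ p) (suc x) (there x∈) = x∉p-x p x x∈

∣p∣≡1+∣p-x∣ : ∀ {n} (p : Subset n) {x} → x ∈ p → ∣ p ∣ ≡ suc ∣ p - x ∣
∣p∣≡1+∣p-x∣ (true ∷ p) here = cong (λ q → suc ∣ q ∣) (sym (p─⊥≡p p))
∣p∣≡1+∣p-x∣ (true ∷ p) (there x∈) = cong suc (∣p∣≡1+∣p-x∣ p x∈)
∣p∣≡1+∣p-x∣ (false ∷ p) (there x∈) = ∣p∣≡1+∣p-x∣ p x∈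

⊆⊥⇒≡⊥ : ∀ {n} {V : Subset n} → V ⊆ ⊥ → V ≡ ⊥
⊆⊥⇒≡⊥ {V = V} s = ⊆-antisym s (⊆-min V)

∁⊥≡⊤ : ∀ {n} → ∁ (⊥ {n}) ≡ ⊤
∁⊥≡⊤ = ⊆-antisym (⊆-max _) (λ _ → x∉p⇒x∈∁p ∉⊥)

∁⊤≡⊥ : ∀ {n} → ∁ (⊤ {n}) ≡ ⊥
∁⊤≡⊥ = ⊆⊥⇒≡⊥ (λ x∈ → ⊥-elim (x∈∁p⇒x∉p x∈ ∈⊤))

∣p∪⁅x⁆∣ : ∀ {n} (p : Subset n) {x} → x ∉ p → ∣ p ∪ ⁅ x ⁆ ∣ ≡ suc ∣ p ∣
∣p∪⁅x⁆∣ {suc n} (false ∷ p) {zero} _ = cong suc (cong ∣_∣ (∪-identityʳ p))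
∣p∪⁅x⁆∣ (true ∷ p) {zero} x∉ = ⊥-elim (x∉ here)
∣p∪⁅x⁆∣ (true ∷ p) {suc x} x∉ = cong suc (∣p∪⁅x⁆∣ p (λ x∈ → x∉ (there x∈)))
∣p∪⁅x⁆∣ (false ∷ p) {suc x} x∉ = ∣p∪⁅x⁆∣ p (λ x∈ → x∉ (there x∈))

∣p∣≡0⇒≡⊥ : ∀ {n} (p : Subset n) → ∣ p ∣ ≡ 0 → p ≡ ⊥
∣p∣≡0⇒≡⊥ [] _ = refl
∣p∣≡0⇒≡⊥ (false ∷ p) e = cong (false ∷_) (∣p∣≡0⇒≡⊥ p e)

1≤∣p∣⇒∈ : ∀ {n} (p : Subset n) → 1 ≤ ∣ p ∣ → Σ (Fin n) (_∈ p)
1≤∣p∣⇒∈ {n} p 1≤ with nonempty? p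
... | yes found = found
... | no empty = ⊥-elim (<-irrefl (sym (trans (cong ∣_∣ (Empty-unique empty)) (∣⊥∣≡0 n))) 1≤)

∣p∣≡1⇒⁅⁆ : ∀ {n} (p : Subset n) → ∣ p ∣ ≡ 1 → Σ (Fin n) λ i → p ≡ ⁅ i ⁆
∣p∣≡1⇒⁅⁆ p e with 1≤∣p∣⇒∈ p (≤-reflexive (sym e))
... | i , i∈ = i , ⊆-antisym only-i (⁅⁆-⊆ i∈)
  where
  rest-empty : p - i ≡ ⊥
  rest-empty = ∣p∣≡0⇒≡⊥ (p - i) (ℕ.suc-injective (trans (sym (∣p∣≡1+∣p-x∣ p i∈)) e))
  only-i : p ⊆ ⁅ i ⁆
  only-i {j} j∈ with j Fin.≟ i
  ... | yes refl = x∈⁅x⁆ i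
  ... | no j≢i = ⊥-elim (∉⊥ (subst (j ∈_) rest-empty (x∈p∧x≢y⇒x∈p-y j∈ j≢i)))

∣p∪q∣≤ : ∀ {n} (p q : Subset n) → ∣ p ∪ q ∣ ≤ ∣ p ∣ + ∣ q ∣
∣p∪q∣≤ [] [] = z≤n
∣p∪q∣≤ (true ∷ p) (b ∷ q) = s≤s (≤-trans (∣p∪q∣≤ p q) (+-monoʳ-≤ ∣ p ∣ (∣p∣≤∣x∷p∣ b q)))
∣p∪q∣≤ (false ∷ p) (true ∷ q) = ≤-trans (s≤s (∣p∪q∣≤ p q)) (≤-reflexive (sym (+-suc ∣ p ∣ ∣ q ∣)))
∣p∪q∣≤ (false ∷ p) (false ∷ q) = ∣p∪q∣≤ p q

∣p⊕q∣≤ : ∀ {n} (p q : Subset n) → ∣ p ⊕ q ∣ ≤ ∣ p ∣ + ∣ q ∣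
∣p⊕q∣≤ [] [] = z≤n
∣p⊕q∣≤ (true ∷ p) (true ∷ q) = ≤-trans (∣p⊕q∣≤ p q) (+-mono-≤ (n≤1+n ∣ p ∣) (n≤1+n ∣ q ∣))
∣p⊕q∣≤ (true ∷ p) (false ∷ q) = s≤s (∣p⊕q∣≤ p q)
∣p⊕q∣≤ (false ∷ p) (true ∷ q) = ≤-trans (s≤s (∣p⊕q∣≤ p q)) (≤-reflexive (sym (+-suc ∣ p ∣ ∣ q ∣)))
∣p⊕q∣≤ (false ∷ p) (false ∷ q) = ∣p⊕q∣≤ p q

∣p∣+∣∁p∣ : ∀ {n} (p : Subset n) → ∣ p ∣ + ∣ ∁ p ∣ ≡ n
∣p∣+∣∁p∣ {n} p = trans (cong (∣ p ∣ +_) (∣∁p∣≡n∸∣p∣ p)) (m+[n∸m]≡n (∣p∣≤n p))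

parity-⊥ : ∀ n → parity (⊥ {n}) ≡ false
parity-⊥ zero = refl
parity-⊥ (suc n) = parity-⊥ n

parity-⁅⁆ : ∀ {n} (i : Fin n) → parity ⁅ i ⁆ ≡ true
parity-⁅⁆ {suc n} zero = cong not (parity-⊥ n)
parity-⁅⁆ (suc i) = parity-⁅⁆ i

⊆⁅⁆-even : ∀ {n} {V : Subset n} (i : Fin n) → V ⊆ ⁅ i ⁆ → parity V ≡ false → V ≡ ⊥
⊆⁅⁆-even {V = V} i V⊆ even with nonempty? V
... | no empty = Empty-unique empty
... | yes (j , j∈) = ⊥-elim (true≢false (trans (sym (parity-⁅⁆ i)) (trans (cong parity (sym V≡⁅i⁆)) even)))
  where
  V≡⁅i⁆ : V ≡ ⁅ i ⁆
  V≡⁅i⁆ = ⊆-antisym V⊆ λ k∈ → subst (_∈ V) (trans (x∈⁅y⁆⇒x≡y i (V⊆ j∈)) (sym (x∈⁅y⁆⇒x≡y i k∈))) j∈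

sumCols-cong : ∀ {r n} {A B : Matrix r n} → (∀ i → A i ≡ B i) → ∀ V → sumCols A V ≡ sumCols B V
sumCols-cong {n = zero} eq [] = refl
sumCols-cong {n = suc n} eq (true ∷ V) = cong₂ _⊕_ (eq zero) (sumCols-cong (λ i → eq (suc i)) V)
sumCols-cong {n = suc n} eq (false ∷ V) = sumCols-cong (λ i → eq (suc i)) V

sumCols-⊥ : ∀ {r n} (A : Matrix r n) → sumCols A ⊥ ≡ 0v
sumCols-⊥ {n = zero} A = refl
sumCols-⊥ {n = suc n} A = sumCols-⊥ (λ i → A (suc i))

sumCols-⁅⁆ : ∀ {r n} (A : Matrix r n) (i : Fin n) → sumCols A ⁅ i ⁆ ≡ A i
sumCols-⁅⁆ A zero = trans (cong (A zero ⊕_) (sumCols-⊥ (λ i → A (suc i)))) (⊕-identityʳ _)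
sumCols-⁅⁆ A (suc i) = sumCols-⁅⁆ (λ j → A (suc j)) i

sumCols-⊕ : ∀ {r n} (A : Matrix r n) (V W : Subset n) → sumCols A (V ⊕ W) ≡ sumCols A V ⊕ sumCols A W
sumCols-⊕ {n = zero} A [] [] = sym (⊕-self 0v)
sumCols-⊕ {n = suc n} A (true ∷ V) (true ∷ W) = begin
  sumCols A′ (V ⊕ W)                      ≡⟨ sumCols-⊕ A′ V W ⟩
  sumCols A′ V ⊕ sumCols A′ W             ≡⟨ ⊕-cancelˡ (A zero) _ ⟨
  A zero ⊕ (A zero ⊕ (sumCols A′ V ⊕ sumCols A′ W)) ≡⟨ cong (A zero ⊕_) (⊕-exchange (A zero) _ _) ⟩
  A zero ⊕ (sumCols A′ V ⊕ (A zero ⊕ sumCols A′ W)) ≡⟨ ⊕-assoc (A zero) _ _ ⟨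
  (A zero ⊕ sumCols A′ V) ⊕ (A zero ⊕ sumCols A′ W) ∎
  where open ≡-Reasoning ; A′ = λ i → A (suc i)
sumCols-⊕ {n = suc n} A (true ∷ V) (false ∷ W) =
  trans (cong (A zero ⊕_) (sumCols-⊕ _ V W)) (sym (⊕-assoc (A zero) _ _))
sumCols-⊕ {n = suc n} A (false ∷ V) (true ∷ W) =
  trans (cong (A zero ⊕_) (sumCols-⊕ _ V W)) (⊕-exchange (A zero) _ _)
sumCols-⊕ {n = suc n} A (false ∷ V) (false ∷ W) = sumCols-⊕ _ V W

sumCols-· : ∀ {r n} (A : Matrix r n) b V → sumCols A (b · V) ≡ b · sumCols A V
sumCols-· A true V = refl
sumCols-· A false V = sumCols-⊥ A

sumCols-pointwise : ∀ {r n} (A B : Matrix r n) V →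
  sumCols (λ i → A i ⊕ B i) V ≡ sumCols A V ⊕ sumCols B V
sumCols-pointwise {n = zero} A B [] = sym (⊕-self 0v)
sumCols-pointwise {n = suc n} A B (false ∷ V) = sumCols-pointwise _ _ V
sumCols-pointwise {n = suc n} A B (true ∷ V) = begin
  (A zero ⊕ B zero) ⊕ sumCols (λ i → A (suc i) ⊕ B (suc i)) V
    ≡⟨ cong ((A zero ⊕ B zero) ⊕_) (sumCols-pointwise _ _ V) ⟩
  (A zero ⊕ B zero) ⊕ (sA ⊕ sB)   ≡⟨ ⊕-assoc (A zero) _ _ ⟩
  A zero ⊕ (B zero ⊕ (sA ⊕ sB))   ≡⟨ cong (A zero ⊕_) (⊕-exchange (B zero) _ _) ⟩
  A zero ⊕ (sA ⊕ (B zero ⊕ sB))   ≡⟨ ⊕-assoc (A zero) _ _ ⟨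
  (A zero ⊕ sA) ⊕ (B zero ⊕ sB)   ∎
  where
  open ≡-Reasoning
  sA = sumCols (λ i → A (suc i)) V
  sB = sumCols (λ i → B (suc i)) V

sumCols-multiples : ∀ {r n} (h : Fin n → Bool) (w : Vec Bool r) V →
  Σ Bool λ p → sumCols (λ i → h i · w) V ≡ p · w
sumCols-multiples {n = zero} h w [] = false , refl
sumCols-multiples {n = suc n} h w (false ∷ V) = sumCols-multiples (λ i → h (suc i)) w V
sumCols-multiples {n = suc n} h w (true ∷ V) with sumCols-multiples (λ i → h (suc i)) w V
... | p , eq = h zero xor p , trans (cong (h zero · w ⊕_) eq) (add (h zero) p)
  where
  add : ∀ a b → a · w ⊕ b · w ≡ (a xor b) · w
  add true true = ⊕-self w
  add true false = ⊕-identityʳ w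
  add false b = ⊕-identityˡ (b · w)

sumCols-++ : ∀ {r n m} (B : Matrix r (n + m)) (V : Subset n) (W : Subset m) →
  sumCols B (V ++ W) ≡ sumCols (λ i → B (i ↑ˡ m)) V ⊕ sumCols (λ j → B (n ↑ʳ j)) W
sumCols-++ {n = zero} B [] W = sym (⊕-identityˡ _)
sumCols-++ {n = suc n} B (true ∷ V) W =
  trans (cong (B zero ⊕_) (sumCols-++ (λ i → B (suc i)) V W)) (sym (⊕-assoc (B zero) _ _))
sumCols-++ {n = suc n} B (false ∷ V) W = sumCols-++ (λ i → B (suc i)) V W

sumCols-∷ʳ : ∀ {r n} (A : Matrix r n) c V → sumCols (λ i → A i ∷ʳ c) V ≡ sumCols A V ∷ʳ (c ∧ parity V)
sumCols-∷ʳ {n = zero} A c [] = sym (trans (cong (0v ∷ʳ_) (∧-zeroʳ c)) 0v-∷ʳ)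
sumCols-∷ʳ {n = suc n} A c (true ∷ V) = begin
  (A zero ∷ʳ c) ⊕ sumCols (λ i → A (suc i) ∷ʳ c) V    ≡⟨ cong ((A zero ∷ʳ c) ⊕_) (sumCols-∷ʳ _ c V) ⟩
  (A zero ∷ʳ c) ⊕ (sumCols _ V ∷ʳ (c ∧ parity V))    ≡⟨ ⊕-∷ʳ _ _ c _ ⟩
  (A zero ⊕ sumCols _ V) ∷ʳ (c xor (c ∧ parity V))    ≡⟨ cong (_ ∷ʳ_) (bit c (parity V)) ⟩
  (A zero ⊕ sumCols _ V) ∷ʳ (c ∧ (true xor parity V)) ∎
  where
  open ≡-Reasoning
  bit : ∀ a b → a xor (a ∧ b) ≡ a ∧ (true xor b)
  bit true b = refl
  bit false b = refl
sumCols-∷ʳ {n = suc n} A c (false ∷ V) = sumCols-∷ʳ _ c V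

⊆ᵇ⇒⊆ : ∀ {n} (V U : Subset n) → V ⊆ᵇ U ≡ true → V ⊆ U
⊆ᵇ⇒⊆ (true ∷ V) (true ∷ U) s here = here
⊆ᵇ⇒⊆ (true ∷ V) (true ∷ U) s (there x∈) = there (⊆ᵇ⇒⊆ V U s x∈)
⊆ᵇ⇒⊆ (false ∷ V) (b ∷ U) s (there x∈) = there (⊆ᵇ⇒⊆ V U s x∈)

⊆⇒⊆ᵇ : ∀ {n} (V U : Subset n) → V ⊆ U → V ⊆ᵇ U ≡ true
⊆⇒⊆ᵇ [] [] s = refl
⊆⇒⊆ᵇ (false ∷ V) (b ∷ U) s = ⊆⇒⊆ᵇ V U (drop-∷-⊆ s)
⊆⇒⊆ᵇ (true ∷ V) (b ∷ U) s with s here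
... | here = ⊆⇒⊆ᵇ V U (drop-∷-⊆ s)

nonemptyᵇ-false : ∀ {n} (V : Subset n) → nonemptyᵇ V ≡ false → V ≡ ⊥
nonemptyᵇ-false [] _ = refl
nonemptyᵇ-false (false ∷ V) e = cong (false ∷_) (nonemptyᵇ-false V e)

nonemptyᵇ-⊥ : ∀ n → nonemptyᵇ (⊥ {n}) ≡ false
nonemptyᵇ-⊥ zero = refl
nonemptyᵇ-⊥ (suc n) = nonemptyᵇ-⊥ n

isZeroᵇ-true : ∀ {r} (v : Vec Bool r) → isZeroᵇ v ≡ true → v ≡ 0v
isZeroᵇ-true [] _ = refl
isZeroᵇ-true (false ∷ v) e = cong (false ∷_) (isZeroᵇ-true v e)

isZeroᵇ-0v : ∀ r → isZeroᵇ (0v {r}) ≡ true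
isZeroᵇ-0v zero = refl
isZeroᵇ-0v (suc r) = isZeroᵇ-0v r

allSubsets-complete : ∀ {n} (V : Subset n) → V ∈ˡ allSubsets n
allSubsets-complete [] = Any.here refl
allSubsets-complete {suc n} (true ∷ V) = ∈-++⁺ˡ (∈-map⁺ (true ∷_) (allSubsets-complete V))
allSubsets-complete {suc n} (false ∷ V) =
  ∈-++⁺ʳ (List.map (true ∷_) (allSubsets n)) (∈-map⁺ (false ∷_) (allSubsets-complete V))

allᵇ-sound : {A : Set} (p : A → Bool) {xs : List A} {x : A} → allᵇ p xs ≡ true → x ∈ˡ xs → p x ≡ true
allᵇ-sound p {y List.∷ _} e (Any.here refl) with p y
... | true = refl
allᵇ-sound p {y List.∷ _} e (Any.there x∈) with p y
... | true = allᵇ-sound p e x∈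

allᵇ-complete : {A : Set} (p : A → Bool) → (∀ x → p x ≡ true) → ∀ xs → allᵇ p xs ≡ true
allᵇ-complete p h List.[] = refl
allᵇ-complete p h (x List.∷ xs) rewrite h x = allᵇ-complete p h xs

maxOver : {A : Set} → (A → ℕ) → List A → ℕ
maxOver f xs = List.foldr _⊔_ 0 (List.map f xs)

≤-maxOver : {A : Set} (f : A → ℕ) {xs : List A} {x : A} → x ∈ˡ xs → f x ≤ maxOver f xs
≤-maxOver f (Any.here refl) = m≤m⊔n _ _
≤-maxOver f {y List.∷ _} (Any.there x∈) = ≤-trans (≤-maxOver f x∈) (m≤n⊔m (f y) _)

maxOver-≤ : {A : Set} (f : A → ℕ) {b : ℕ} → (∀ x → f x ≤ b) → ∀ xs → maxOver f xs ≤ b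
maxOver-≤ f h List.[] = z≤n
maxOver-≤ f h (x List.∷ xs) = ⊔-lub (h x) (maxOver-≤ f h xs)

maxOver-attained : {A : Set} (f : A → ℕ) (xs : List A) → maxOver f xs ≡ 0 ⊎ Σ A (λ x → maxOver f xs ≡ f x)
maxOver-attained f List.[] = inj₁ refl
maxOver-attained f (x List.∷ xs) with ⊔-sel (f x) (maxOver f xs)
... | inj₁ e = inj₂ (x , e)
... | inj₂ e with maxOver-attained f xs
...   | inj₁ e′ = inj₁ (trans e e′)
...   | inj₂ (y , e′) = inj₂ (y , trans e e′)

Indep : ∀ {r n} → Matrix r n → Subset n → Set
Indep A U = ∀ V → V ⊆ U → sumCols A V ≡ 0v → V ≡ ⊥

Indep-⊥ : ∀ {r n} (A : Matrix r n) → Indep A ⊥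
Indep-⊥ A V s _ = ⊆⊥⇒≡⊥ s

module _ {r n : ℕ} (A : Matrix r n) (U : Subset n) where

  private
    test : Subset n → Bool
    test V = not (V ⊆ᵇ U ∧ nonemptyᵇ V) ∨ not (isZeroᵇ (sumCols A V))

  independentᵇ⇒Indep : independentᵇ A U ≡ true → Indep A U
  independentᵇ⇒Indep e V V⊆U z = nonemptyᵇ-false V (lemma (allᵇ-sound test e (allSubsets-complete V)))
    where
    lemma : test V ≡ true → nonemptyᵇ V ≡ false
    lemma t rewrite ⊆⇒⊆ᵇ V U V⊆U | z | isZeroᵇ-0v r with nonemptyᵇ V
    ... | false = refl

  Indep⇒independentᵇ : Indep A U → independentᵇ A U ≡ true
  Indep⇒independentᵇ ind = allᵇ-complete test passes (allSubsets n)
    where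
    passes : ∀ V → test V ≡ true
    passes V with V ⊆ᵇ U in sub | nonemptyᵇ V in ne | isZeroᵇ (sumCols A V) in z
    ... | false | _ | _ = refl
    ... | true | false | _ = refl
    ... | true | true | false = refl
    ... | true | true | true with ind V (⊆ᵇ⇒⊆ V U sub) (isZeroᵇ-true _ z)
    ...   | refl = ⊥-elim (true≢false (trans (sym ne) (nonemptyᵇ-⊥ n)))

Independent⇒Indep : ∀ {r n} (A : Matrix r n) U → Independent A U → Indep A U
Independent⇒Indep A U t = independentᵇ⇒Indep A U (Equivalence.to T-≡ t)

module _ {r n : ℕ} (A : Matrix r n) (Y : Subset n) where

  private
    size : Subset n → ℕ
    size U = if U ⊆ᵇ Y ∧ independentᵇ A U then ∣ U ∣ else 0

  rank-≥ : ∀ {U} → U ⊆ Y → Indep A U → ∣ U ∣ ≤ rank A Y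
  rank-≥ {U} U⊆Y ind = ≤-trans (≤-reflexive counted) (≤-maxOver size (allSubsets-complete U))
    where
    counted : ∣ U ∣ ≡ size U
    counted rewrite ⊆⇒⊆ᵇ U Y U⊆Y | Indep⇒independentᵇ A U ind = refl

  rank-≤ : ∀ {b} → (∀ U → U ⊆ Y → Indep A U → ∣ U ∣ ≤ b) → rank A Y ≤ b
  rank-≤ {b} h = maxOver-≤ size bounded (allSubsets n)
    where
    bounded : ∀ U → size U ≤ b
    bounded U with U ⊆ᵇ Y in sub | independentᵇ A U in ind
    ... | true | true = h U (⊆ᵇ⇒⊆ U Y sub) (independentᵇ⇒Indep A U ind)
    ... | true | false = z≤n
    ... | false | _ = z≤n

  private
    empty-basis : rank A Y ≡ 0 → Σ (Subset n) λ U → U ⊆ Y × Indep A U × rank A Y ≡ ∣ U ∣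
    empty-basis e = ⊥ , ⊆-min Y , Indep-⊥ A , trans e (sym (∣⊥∣≡0 n))

  rank-basis : Σ (Subset n) λ U → U ⊆ Y × Indep A U × rank A Y ≡ ∣ U ∣
  rank-basis with maxOver-attained size (allSubsets n)
  ... | inj₁ e = empty-basis e
  ... | inj₂ (U , e) with U ⊆ᵇ Y in sub | independentᵇ A U in ind
  ...   | true | true = U , ⊆ᵇ⇒⊆ U Y sub , independentᵇ⇒Indep A U ind , e
  ...   | true | false = empty-basis e
  ...   | false | _ = empty-basis e

  rank-≤-size : rank A Y ≤ ∣ Y ∣
  rank-≤-size = rank-≤ (λ U U⊆Y _ → p⊆q⇒∣p∣≤∣q∣ U⊆Y)

rank-mono : ∀ {r n} (A : Matrix r n) {Y Z : Subset n} → Y ⊆ Z → rank A Y ≤ rank A Z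
rank-mono A {Y} {Z} Y⊆Z with rank-basis A Y
... | U , U⊆Y , ind , e = ≤-trans (≤-reflexive e) (rank-≥ A Z (⊆-trans U⊆Y Y⊆Z) ind)

rank-dependent : ∀ {r n} (A : Matrix r n) Y → ¬ Indep A Y → rank A Y < ∣ Y ∣
rank-dependent A Y dep with rank-basis A Y
... | U , U⊆Y , ind , e =
  ≤∧≢⇒< (rank-≤-size A Y) λ eq → dep (subst (Indep A) (⊆-size-≡ U⊆Y (≤-reflexive (trans (sym eq) e))) ind)

-- A basis of the whole ground set spans every column.  If a column A s
-- were not a combination of the basis U0, then U0 ∪ {s} would be a larger
-- independent set.
basis-spans : ∀ {r n} (A : Matrix r n) {U0 : Subset n} → Indep A U0 → rank A ⊤ ≡ ∣ U0 ∣ →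
  ∀ s → Σ (Subset n) λ c → c ⊆ U0 × sumCols A c ≡ A s
basis-spans {n = n} A {U0} indU0 maximal s
  with anySubset? {n = n} (λ c → (c ⊆? U0) ×-dec ≡-dec Bool._≟_ (sumCols A c) (A s))
... | yes found = found
... | no none = ⊥-elim (<-irrefl refl larger)
  where
  s∉U0 : s ∉ U0
  s∉U0 s∈ = none (⁅ s ⁆ , ⁅⁆-⊆ s∈ , sumCols-⁅⁆ A s)
  -- a vanishing combination V of U0 ∪ {s} cannot use s, hence is trivial
  indep : Indep A (U0 ∪ ⁅ s ⁆)
  indep V V⊆ z with s ∈? V
  ... | yes s∈V = ⊥-elim (none (V ⊕ ⁅ s ⁆ , ⊆U0 , sums))
    where
    ⊆U0 : V ⊕ ⁅ s ⁆ ⊆ U0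
    ⊆U0 {y} y∈ with ∈-⊕⁻ V ⁅ s ⁆ y∈
    ... | inj₂ (y∉V , y∈s) = ⊥-elim (y∉V (subst (_∈ V) (sym (x∈⁅y⁆⇒x≡y s y∈s)) s∈V))
    ... | inj₁ (y∈V , y∉s) with x∈p∪q⁻ U0 ⁅ s ⁆ (V⊆ y∈V)
    ...   | inj₁ y∈U0 = y∈U0
    ...   | inj₂ y∈s = ⊥-elim (y∉s y∈s)
    sums : sumCols A (V ⊕ ⁅ s ⁆) ≡ A s
    sums = trans (sumCols-⊕ A V ⁅ s ⁆) (trans (cong₂ _⊕_ z (sumCols-⁅⁆ A s)) (⊕-identityˡ (A s)))
  ... | no s∉V = indU0 V V⊆U0 z
    where
    V⊆U0 : V ⊆ U0
    V⊆U0 {y} y∈ with x∈p∪q⁻ U0 ⁅ s ⁆ (V⊆ y∈)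
    ... | inj₁ y∈U0 = y∈U0
    ... | inj₂ y∈s = ⊥-elim (s∉V (subst (_∈ V) (x∈⁅y⁆⇒x≡y s y∈s) y∈))
  larger : suc (rank A ⊤) ≤ rank A ⊤
  larger = begin
    suc (rank A ⊤)      ≡⟨ cong suc maximal ⟩
    suc ∣ U0 ∣          ≡⟨ ∣p∪⁅x⁆∣ U0 s∉U0 ⟨
    ∣ U0 ∪ ⁅ s ⁆ ∣      ≤⟨ rank-≥ A ⊤ (⊆-max _) indep ⟩
    rank A ⊤            ∎
    where open ≤-Reasoning

-- Steinitz exchange lemma over GF(2)
--
-- The proof
-- eliminates the first column β of B: when some column of U uses β, it
-- serves as a pivot that is added to every other column using β, which
-- removes β from all coefficient vectors at the cost of one element of U.

sumCols-tail : ∀ {d b} (B : Matrix d (suc b)) (c : Subset (suc b)) → Vec.head c ≡ false →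
  sumCols (λ j → B (suc j)) (Vec.tail c) ≡ sumCols B c
sumCols-tail B (false ∷ c) _ = refl

sumCols-zeros : ∀ {r n} (A : Matrix r n) V → (∀ {i} → i ∈ V → A i ≡ 0v) → sumCols A V ≡ 0v
sumCols-zeros {n = zero} A [] _ = refl
sumCols-zeros {n = suc n} A (false ∷ V) z = sumCols-zeros _ V (λ i∈ → z (there i∈))
sumCols-zeros {n = suc n} A (true ∷ V) z =
  trans (cong₂ _⊕_ (z here) (sumCols-zeros _ V (λ i∈ → z (there i∈)))) (⊕-self 0v)

Spans : ∀ {d b n} → Matrix d b → Subset b → Matrix d n → Subset n → (Fin n → Subset b) → Set
Spans B W C U coef = ∀ {i} → i ∈ U → coef i ⊆ W × sumCols B (coef i) ≡ C i

module Pivot {d b n} (B : Matrix d (suc b)) (C : Matrix d n) (coef : Fin n → Subset (suc b))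
             (i0 : Fin n) (uses : Vec.head (coef i0) ≡ true) where

  uses-first : Fin n → Bool
  uses-first i = Vec.head (coef i)

  C′ : Matrix d n
  C′ i = C i ⊕ uses-first i · C i0

  coef′ : Fin n → Subset b
  coef′ i = Vec.tail (coef i ⊕ uses-first i · coef i0)

  first-cleared : ∀ i → Vec.head (coef i ⊕ uses-first i · coef i0) ≡ false
  first-cleared i = cleared (coef i) (coef i0) uses
    where
    cleared : ∀ (c c₀ : Subset (suc b)) → Vec.head c₀ ≡ true → Vec.head (c ⊕ Vec.head c · c₀) ≡ false
    cleared (true ∷ c) (true ∷ c₀) _ = refl
    cleared (false ∷ c) c₀ _ = refl

  spans′ : ∀ {W U} → Spans B W C U coef → i0 ∈ U → Spans (λ j → B (suc j)) (Vec.tail W) C′ (U - i0) coef′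
  spans′ {W} {U} spans i0∈U {i} i∈ = ⊆-tail (⊕-⊆ ci⊆W (·-⊆ (uses-first i) c0⊆W)) , sums
    where
    i∈U = p─q⊆p U ⁅ i0 ⁆ i∈
    ci⊆W = proj₁ (spans i∈U)
    c0⊆W = proj₁ (spans i0∈U)
    h = uses-first i
    sums : sumCols (λ j → B (suc j)) (coef′ i) ≡ C′ i
    sums = begin
      sumCols (λ j → B (suc j)) (coef′ i)        ≡⟨ sumCols-tail B (coef i ⊕ h · coef i0) (first-cleared i) ⟩
      sumCols B (coef i ⊕ h · coef i0)           ≡⟨ sumCols-⊕ B (coef i) (h · coef i0) ⟩
      sumCols B (coef i) ⊕ sumCols B (h · coef i0) ≡⟨ cong (_ ⊕_) (sumCols-· B h _) ⟩
      sumCols B (coef i) ⊕ h · sumCols B (coef i0)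
        ≡⟨ cong₂ (λ u v → u ⊕ h · v) (proj₂ (spans i∈U)) (proj₂ (spans i0∈U)) ⟩
      C′ i                                       ∎
      where open ≡-Reasoning

  -- A vanishing combination V of C′ over U - i0 gives the vanishing
  -- combination V ⊕ p·{i0} of C over U, so V = p·{i0}; as i0 ∉ V, V = ⊥.
  indep′ : ∀ {U} → Indep C U → i0 ∈ U → Indep C′ (U - i0)
  indep′ {U} ind i0∈U V V⊆ z with sumCols-multiples uses-first (C i0) V
  ... | p , multiple = V≡⊥ p (⊕≡0⇒≡ V (p · ⁅ i0 ⁆) (ind _ (⊕-⊆ V⊆U (·-⊆ p i0⊆U)) vanishes))
    where
    V⊆U : V ⊆ U
    V⊆U = ⊆-trans V⊆ (p─q⊆p U ⁅ i0 ⁆)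
    i0⊆U : ⁅ i0 ⁆ ⊆ U
    i0⊆U = ⁅⁆-⊆ i0∈U
    vanishes : sumCols C (V ⊕ p · ⁅ i0 ⁆) ≡ 0v
    vanishes = begin
      sumCols C (V ⊕ p · ⁅ i0 ⁆)                        ≡⟨ sumCols-⊕ C V _ ⟩
      sumCols C V ⊕ sumCols C (p · ⁅ i0 ⁆)              ≡⟨ cong (_ ⊕_) (sumCols-· C p ⁅ i0 ⁆) ⟩
      sumCols C V ⊕ p · sumCols C ⁅ i0 ⁆                ≡⟨ cong (λ v → _ ⊕ p · v) (sumCols-⁅⁆ C i0) ⟩
      sumCols C V ⊕ p · C i0                            ≡⟨ cong (_ ⊕_) multiple ⟨
      sumCols C V ⊕ sumCols (λ i → uses-first i · C i0) V ≡⟨ sumCols-pointwise C _ V ⟨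
      sumCols C′ V                                      ≡⟨ z ⟩
      0v                                                ∎
      where open ≡-Reasoning
    V≡⊥ : ∀ p → V ≡ p · ⁅ i0 ⁆ → V ≡ ⊥
    V≡⊥ false e = e
    V≡⊥ true e = ⊥-elim (x∉p-x U i0 (V⊆ (subst (i0 ∈_) (sym e) (x∈⁅x⁆ i0))))

steinitz : ∀ {d b n} (B : Matrix d b) (W : Subset b) (C : Matrix d n) (U : Subset n)
  (coef : Fin n → Subset b) → Indep C U → Spans B W C U coef → ∣ U ∣ ≤ ∣ W ∣
steinitz {b = zero} {n} B [] C U coef ind spans =
  ≤-reflexive (trans (cong ∣_∣ (ind U ⊆-refl (sumCols-zeros C U zero-column))) (∣⊥∣≡0 n))
  where
  zero-column : ∀ {i} → i ∈ U → C i ≡ 0v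
  zero-column i∈ = trans (sym (proj₂ (spans i∈))) (no-columns (coef _))
    where
    no-columns : (c : Subset 0) → sumCols B c ≡ 0v
    no-columns [] = refl
steinitz {b = suc b} B (w ∷ W) C U coef ind spans
  with any? (λ i → (i ∈? U) ×-dec (Vec.head (coef i) Bool.≟ true))
... | no none = ≤-trans (steinitz (λ j → B (suc j)) W C U (λ i → Vec.tail (coef i)) ind spans′) (∣p∣≤∣x∷p∣ w W)
  where
  unused : ∀ {i} → i ∈ U → Vec.head (coef i) ≡ false
  unused {i} i∈ with Vec.head (coef i) in e
  ... | false = refl
  ... | true = ⊥-elim (none (i , i∈ , e))
  spans′ : Spans (λ j → B (suc j)) W C U (λ i → Vec.tail (coef i))
  spans′ i∈ = ⊆-tail (proj₁ (spans i∈)) , trans (sumCols-tail B (coef _) (unused i∈)) (proj₂ (spans i∈))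
... | yes (i0 , i0∈U , uses) = begin
  ∣ U ∣          ≡⟨ ∣p∣≡1+∣p-x∣ U i0∈U ⟩
  suc ∣ U - i0 ∣ ≤⟨ s≤s (steinitz _ W C′ (U - i0) coef′ (indep′ ind i0∈U) (spans′ spans i0∈U)) ⟩
  suc ∣ W ∣      ≡⟨ cong (λ w → ∣ w ∷ W ∣) (w≡true (coef i0) uses (proj₁ (spans i0∈U))) ⟨
  ∣ w ∷ W ∣      ∎
  where
  open Pivot B C coef i0 uses
  open ≤-Reasoning
  w≡true : ∀ c → Vec.head c ≡ true → c ⊆ w ∷ W → w ≡ true
  w≡true (true ∷ _) _ c⊆ with c⊆ here
  ... | here = refl

++-⊆⁻ : ∀ {n m} {VS US : Subset n} {VG UG : Subset m} → VS ++ VG ⊆ US ++ UG → VS ⊆ US × VG ⊆ UG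
++-⊆⁻ {VS = []} {[]} s = (λ ()) , s
++-⊆⁻ {VS = a ∷ VS} {b ∷ US} s with ++-⊆⁻ {VS = VS} {US} (drop-∷-⊆ s)
... | sS , sG = head-⊆ , sG
  where
  head-⊆ : a ∷ VS ⊆ b ∷ US
  head-⊆ here with s here
  ... | here = here
  head-⊆ (there x∈) = there (sS x∈)

++-⊆⁺ : ∀ {n m} {VS US : Subset n} {VG UG : Subset m} → VS ⊆ US → VG ⊆ UG → VS ++ VG ⊆ US ++ UG
++-⊆⁺ {VS = []} {[]} sS sG = sG
++-⊆⁺ {VS = a ∷ VS} {b ∷ US} sS sG here with sS here
... | here = here
++-⊆⁺ {VS = a ∷ VS} {b ∷ US} sS sG (there x∈) = there (++-⊆⁺ (drop-∷-⊆ sS) sG x∈)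

∣++∣ : ∀ {n m} (p : Subset n) (q : Subset m) → ∣ p ++ q ∣ ≡ ∣ p ∣ + ∣ q ∣
∣++∣ [] q = refl
∣++∣ (true ∷ p) q = cong suc (∣++∣ p q)
∣++∣ (false ∷ p) q = ∣++∣ p q

∁-++ : ∀ {n m} (p : Subset n) (q : Subset m) → ∁ (p ++ q) ≡ ∁ p ++ ∁ q
∁-++ = map-++ not

⊥++⊥ : ∀ n m → ⊥ {n} ++ ⊥ {m} ≡ ⊥
⊥++⊥ zero m = refl
⊥++⊥ (suc n) m = cong (false ∷_) (⊥++⊥ n m)

⊤++⊤ : ∀ n m → ⊤ {n} ++ ⊤ {m} ≡ ⊤
⊤++⊤ zero m = refl
⊤++⊤ (suc n) m = cong (true ∷_) (⊤++⊤ n m)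

split : ∀ {n m} (P : Subset (n + m)) → Σ (Subset n) λ PS → Σ (Subset m) λ PG → P ≡ PS ++ PG
split {n} P = Vec.take n P , Vec.drop n P , sym (take++drop≡id n P)

-- The Γ-image of a set of new elements: the GF(2)-sum of the singletons
-- {x i}, i ∈ V.  Its column sum in M equals the column sum of V in the
-- copied columns A ∘ x.
push : ∀ {m n} (x : Fin m → Fin n) → Subset m → Subset n
push {zero} x [] = ⊥
push {suc m} x (b ∷ V) = b · ⁅ x zero ⁆ ⊕ push (λ i → x (suc i)) V

sumCols-push : ∀ {r m n} (A : Matrix r n) (x : Fin m → Fin n) V → sumCols A (push x V) ≡ sumCols (λ i → A (x i)) V
sumCols-push A x [] = sumCols-⊥ A
sumCols-push A x (b ∷ V) = begin
  sumCols A (b · ⁅ x zero ⁆ ⊕ push _ V)          ≡⟨ sumCols-⊕ A _ _ ⟩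
  sumCols A (b · ⁅ x zero ⁆) ⊕ sumCols A (push _ V) ≡⟨ cong₂ _⊕_ (sumCols-· A b _) (sumCols-push A _ V) ⟩
  b · sumCols A ⁅ x zero ⁆ ⊕ sumCols _ V          ≡⟨ cong (λ v → b · v ⊕ _) (sumCols-⁅⁆ A (x zero)) ⟩
  b · A (x zero) ⊕ sumCols _ V                    ≡⟨ lemma b ⟩
  sumCols (λ i → A (x i)) (b ∷ V)                 ∎
  where
  open ≡-Reasoning
  lemma : ∀ b → b · A (x zero) ⊕ sumCols (λ i → A (x (suc i))) V ≡ sumCols (λ i → A (x i)) (b ∷ V)
  lemma true = refl
  lemma false = ⊕-identityˡ _

push-⊥ : ∀ {m n} (x : Fin m → Fin n) → push x ⊥ ≡ ⊥
push-⊥ {zero} x = refl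
push-⊥ {suc m} x = trans (⊕-identityˡ _) (push-⊥ (λ i → x (suc i)))

push-⊆ : ∀ {m n} (x : Fin m → Fin n) (V : Subset m) {Z : Subset n} →
  (∀ {i} → i ∈ V → x i ∈ Z) → push x V ⊆ Z
push-⊆ x [] h = ⊆-min _
push-⊆ x (true ∷ V) h = ⊕-⊆ (⁅⁆-⊆ (h here)) (push-⊆ _ V (λ i∈ → h (there i∈)))
push-⊆ x (false ∷ V) h = ⊕-⊆ (⊆-min _) (push-⊆ _ V (λ i∈ → h (there i∈)))

push-∉ : ∀ {m n} (x : Fin m → Fin n) (V : Subset m) {y} → (∀ i → x i ≢ y) → y ∉ push x V
push-∉ x [] _ = ∉⊥
push-∉ x (b ∷ V) avoids y∈ with ∈-⊕⁻ (b · ⁅ x zero ⁆) _ y∈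
... | inj₂ (_ , y∈′) = push-∉ _ V (λ i → avoids (suc i)) y∈′
... | inj₁ (y∈′ , _) with b
...   | true = avoids zero (sym (x∈⁅y⁆⇒x≡y _ y∈′))
...   | false = ∉⊥ y∈′

-- for injective x, push is an honest image
∈-push : ∀ {m n} (x : Fin m → Fin n) → Injective _≡_ _≡_ x → ∀ {V i} → i ∈ V → x i ∈ push x V
∈-push x inj {true ∷ V} here =
  ∈-⊕⁺ˡ ⁅ x zero ⁆ _ (x∈⁅x⁆ _) (push-∉ _ V λ i e → 0≢1+n (inj (sym e)))
∈-push x inj {true ∷ V} (there i∈) =
  ∈-⊕⁺ʳ ⁅ x zero ⁆ _ (λ y∈ → 0≢1+n (inj (sym (x∈⁅y⁆⇒x≡y _ y∈)))) (∈-push _ (λ e → suc-injective (inj e)) i∈)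
∈-push x inj {false ∷ V} (there i∈) =
  ∈-⊕⁺ʳ ⊥ _ ∉⊥ (∈-push _ (λ e → suc-injective (inj e)) i∈)

∣push∣≤ : ∀ {m n} (x : Fin m → Fin n) V → ∣ push x V ∣ ≤ ∣ V ∣
∣push∣≤ {n = n} x [] = ≤-reflexive (∣⊥∣≡0 n)
∣push∣≤ x (true ∷ V) = begin
  ∣ ⁅ x zero ⁆ ⊕ push x′ V ∣          ≤⟨ ∣p⊕q∣≤ ⁅ x zero ⁆ (push x′ V) ⟩
  ∣ ⁅ x zero ⁆ ∣ + ∣ push x′ V ∣      ≡⟨ cong (_+ ∣ push x′ V ∣) (∣⁅x⁆∣≡1 (x zero)) ⟩
  suc ∣ push x′ V ∣                   ≤⟨ s≤s (∣push∣≤ x′ V) ⟩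
  suc ∣ V ∣                           ∎
  where
  open ≤-Reasoning
  x′ = λ i → x (suc i)
∣push∣≤ x (false ∷ V) =
  subst (λ p → ∣ p ∣ ≤ ∣ V ∣) (sym (⊕-identityˡ (push (λ i → x (suc i)) V))) (∣push∣≤ (λ i → x (suc i)) V)

push-⊆⁅⁆-even : ∀ {m n} (x : Fin m → Fin n) → Injective _≡_ _≡_ x → ∀ {V s} →
  push x V ⊆ ⁅ s ⁆ → parity V ≡ false → V ≡ ⊥
push-⊆⁅⁆-even x inj {V} {s} push⊆ even with nonempty? V
... | no empty = Empty-unique empty
... | yes (i , i∈) = ⊆⁅⁆-even i (λ j∈ → subst (_∈ ⁅ i ⁆) (sym (same j∈)) (x∈⁅x⁆ i)) even
  where
  onto-s : ∀ {j} → j ∈ V → x j ≡ s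
  onto-s j∈ = x∈⁅y⁆⇒x≡y s (push⊆ (∈-push x inj j∈))
  same : ∀ {j} → j ∈ V → j ≡ i
  same j∈ = inj (trans (onto-s j∈) (sym (onto-s i∈)))

∈-image : ∀ {m n} (x : Fin m → Fin n) i → x i ∈ image x
∈-image x zero = x∈p∪q⁺ (inj₁ (x∈⁅x⁆ (x zero)))
∈-image x (suc i) = x∈p∪q⁺ (inj₂ (∈-image (λ j → x (suc j)) i))

-- The Γ-extension N = M^X: its columns and its independent sets

module Extension {r n m : ℕ} (A : Matrix r n) (x : Fin m → Fin n) where

  N : Matrix (suc r) (n + m)
  N = ΓExt A x

  N-S : ∀ i → N (i ↑ˡ m) ≡ A i ∷ʳ false
  N-S i with splitAt n (i ↑ˡ m) | splitAt-↑ˡ n i m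
  ... | .(inj₁ i) | refl = refl

  N-Γ : ∀ j → N (n ↑ʳ j) ≡ A (x j) ∷ʳ true
  N-Γ j with splitAt n (n ↑ʳ j) | splitAt-↑ʳ n m j
  ... | .(inj₂ j) | refl = refl

  sumCols-N : ∀ VS VG → sumCols N (VS ++ VG) ≡ sumCols A (VS ⊕ push x VG) ∷ʳ parity VG
  sumCols-N VS VG = begin
    sumCols N (VS ++ VG)
      ≡⟨ sumCols-++ N VS VG ⟩
    sumCols (λ i → N (i ↑ˡ m)) VS ⊕ sumCols (λ j → N (n ↑ʳ j)) VG
      ≡⟨ cong₂ _⊕_ (sumCols-cong N-S VS) (sumCols-cong N-Γ VG) ⟩
    sumCols (λ i → A i ∷ʳ false) VS ⊕ sumCols (λ j → A (x j) ∷ʳ true) VG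
      ≡⟨ cong₂ _⊕_ (sumCols-∷ʳ A false VS) (sumCols-∷ʳ (λ j → A (x j)) true VG) ⟩
    (sumCols A VS ∷ʳ false) ⊕ (sumCols (λ j → A (x j)) VG ∷ʳ parity VG)
      ≡⟨ ⊕-∷ʳ _ _ false (parity VG) ⟩
    (sumCols A VS ⊕ sumCols (λ j → A (x j)) VG) ∷ʳ parity VG
      ≡⟨ cong (λ v → (sumCols A VS ⊕ v) ∷ʳ parity VG) (sumCols-push A x VG) ⟨
    (sumCols A VS ⊕ sumCols A (push x VG)) ∷ʳ parity VG
      ≡⟨ cong (_∷ʳ parity VG) (sumCols-⊕ A VS (push x VG)) ⟨
    sumCols A (VS ⊕ push x VG) ∷ʳ parity VG
      ∎
    where open ≡-Reasoning

  vanishing-N : ∀ VS VG → sumCols N (VS ++ VG) ≡ 0v →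
    sumCols A (VS ⊕ push x VG) ≡ 0v × parity VG ≡ false
  vanishing-N VS VG z = ∷ʳ-injective _ _ (trans (sym (sumCols-N VS VG)) (trans z (sym 0v-∷ʳ)))

  indep-N-odd : ∀ {U W} → Indep A U → (∀ V → V ⊆ W → parity V ≡ false → V ≡ ⊥) → Indep N (U ++ W)
  indep-N-odd {U} {W} indU odd V V⊆ z with split {n} {m} V
  ... | VS , VG , refl with ++-⊆⁻ V⊆ | vanishing-N VS VG z
  ...   | VS⊆U , VG⊆W | zS , even with odd VG VG⊆W even
  ...     | refl = begin
    VS ++ ⊥       ≡⟨ cong (_++ ⊥) (indU VS VS⊆U zS′) ⟩
    ⊥ {n} ++ ⊥    ≡⟨ ⊥++⊥ n m ⟩
    ⊥             ∎
    where
    open ≡-Reasoning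
    zS′ : sumCols A VS ≡ 0v
    zS′ = trans (cong (sumCols A) (sym (trans (cong (VS ⊕_) (push-⊥ x)) (⊕-identityʳ VS)))) zS

  -- U ++ W is independent in N when U and the image of W lie in an
  -- independent set Z of M and no non-empty even subset of W has its image
  -- inside U.  (A vanishing combination VS ++ VG forces VS = push x VG.)
  indep-N-image : ∀ {Z U W} → Indep A Z → U ⊆ Z → (∀ {i} → i ∈ W → x i ∈ Z) →
    (∀ V → V ⊆ W → parity V ≡ false → push x V ⊆ U → V ≡ ⊥) → Indep N (U ++ W)
  indep-N-image {Z} {U} {W} indZ U⊆Z W↦Z odd V V⊆ z with split {n} {m} V
  ... | VS , VG , refl = begin
    VS ++ VG             ≡⟨ cong (_++ VG) VS≡push ⟩
    push x VG ++ VG      ≡⟨ cong (λ W → push x W ++ W) VG≡⊥ ⟩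
    push x ⊥ ++ ⊥        ≡⟨ cong (_++ ⊥) (push-⊥ x) ⟩
    ⊥ {n} ++ ⊥           ≡⟨ ⊥++⊥ n m ⟩
    ⊥                    ∎
    where
    open ≡-Reasoning
    VS⊆U = proj₁ (++-⊆⁻ V⊆)
    VG⊆W = proj₂ (++-⊆⁻ V⊆)
    VS≡push : VS ≡ push x VG
    VS≡push = ⊕≡0⇒≡ VS (push x VG) (indZ _ (⊕-⊆ (⊆-trans VS⊆U U⊆Z) (push-⊆ x VG (λ i∈ → W↦Z (VG⊆W i∈))))
                                       (proj₁ (vanishing-N VS VG z)))
    VG≡⊥ : VG ≡ ⊥
    VG≡⊥ = odd VG VG⊆W (proj₂ (vanishing-N VS VG z)) (subst (_⊆ U) VS≡push VS⊆U)

  -- on the old elements, N is M with a zero row added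
  indep-N-S⁻ : ∀ {U} → Indep N (U ++ ⊥) → Indep A U
  indep-N-S⁻ {U} ind V V⊆U z =
    ++-injectiveˡ V ⊥ (trans (ind (V ++ ⊥) (++-⊆⁺ V⊆U ⊆-refl) vanishes) (sym (⊥++⊥ n m)))
    where
    vanishes : sumCols N (V ++ ⊥) ≡ 0v
    vanishes = begin
      sumCols N (V ++ ⊥)                          ≡⟨ sumCols-N V ⊥ ⟩
      sumCols A (V ⊕ push x ⊥) ∷ʳ parity (⊥ {m})
        ≡⟨ cong₂ (λ W p → sumCols A (V ⊕ W) ∷ʳ p) (push-⊥ x) (parity-⊥ m) ⟩
      sumCols A (V ⊕ ⊥) ∷ʳ false                  ≡⟨ cong (λ W → sumCols A W ∷ʳ false) (⊕-identityʳ V) ⟩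
      sumCols A V ∷ʳ false                        ≡⟨ cong (_∷ʳ false) z ⟩
      0v ∷ʳ false                                 ≡⟨ 0v-∷ʳ ⟩
      0v                                          ∎
      where open ≡-Reasoning

  rank-N-odd : ∀ YS {YG W} → W ⊆ YG → (∀ V → V ⊆ W → parity V ≡ false → V ≡ ⊥) →
    rank A YS + ∣ W ∣ ≤ rank N (YS ++ YG)
  rank-N-odd YS {YG} {W} W⊆ odd with rank-basis A YS
  ... | U , U⊆ , indU , e = begin
    rank A YS + ∣ W ∣ ≡⟨ cong (_+ ∣ W ∣) e ⟩
    ∣ U ∣ + ∣ W ∣     ≡⟨ ∣++∣ U W ⟨
    ∣ U ++ W ∣        ≤⟨ rank-≥ N (YS ++ YG) (++-⊆⁺ U⊆ W⊆) (indep-N-odd indU odd) ⟩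
    rank N (YS ++ YG) ∎
    where open ≤-Reasoning

  rank-N-≥-M : ∀ YS YG → rank A YS ≤ rank N (YS ++ YG)
  rank-N-≥-M YS YG = ≤-trans (≤-reflexive (sym (trans (cong (rank A YS +_) (∣⊥∣≡0 m)) (+-identityʳ _))))
                              (rank-N-odd YS (⊆-min YG) (λ V V⊆ _ → ⊆⊥⇒≡⊥ V⊆))

  rank-N->-M : ∀ YS {YG i} → i ∈ YG → rank A YS < rank N (YS ++ YG)
  rank-N->-M YS {YG} {i} i∈ = ≤-trans (≤-reflexive (sym (trans (cong (rank A YS +_) (∣⁅x⁆∣≡1 i)) (+-comm _ 1))))
                                     (rank-N-odd YS (⁅⁆-⊆ i∈) (λ V V⊆ → ⊆⁅⁆-even i V⊆))

  rank-N-≥-Γ : Indep A (image x) → Injective _≡_ _≡_ x → ∀ YS YG → ∣ YG ∣ ≤ rank N (YS ++ YG)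
  rank-N-≥-Γ indX inj YS YG = begin
    ∣ YG ∣            ≡⟨ cong (_+ ∣ YG ∣) (∣⊥∣≡0 n) ⟨
    ∣ ⊥ {n} ∣ + ∣ YG ∣ ≡⟨ ∣++∣ (⊥ {n}) YG ⟨
    ∣ ⊥ {n} ++ YG ∣   ≤⟨ rank-≥ N (YS ++ YG) (++-⊆⁺ (⊆-min YS) ⊆-refl)
                           (indep-N-image indX (⊆-min _) (λ {i} _ → ∈-image x i) image-in-⊥) ⟩
    rank N (YS ++ YG) ∎
    where
    open ≤-Reasoning
    image-in-⊥ : ∀ V → V ⊆ YG → parity V ≡ false → push x V ⊆ ⊥ → V ≡ ⊥
    image-in-⊥ V _ _ push⊆⊥ = ⊆⊥⇒≡⊥ (λ i∈ → ⊥-elim (∉⊥ (push⊆⊥ (∈-push x inj i∈))))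

  -- A basis U0 of M together with one new element γ spans N: the old column
  -- s is the combination c s of U0, and γ_i = (x i ∷ʳ 1) is the combination
  -- c (x i) + c (x γ) + γ.
  module Spanning (γ : Fin m) {U0 : Subset n} (indU0 : Indep A U0) (maximal : rank A ⊤ ≡ ∣ U0 ∣) where

    c : Fin n → Subset n
    c s = proj₁ (basis-spans A indU0 maximal s)

    c⊆ : ∀ s → c s ⊆ U0
    c⊆ s = proj₁ (proj₂ (basis-spans A indU0 maximal s))

    c-sum : ∀ s → sumCols A (c s) ≡ A s
    c-sum s = proj₂ (proj₂ (basis-spans A indU0 maximal s))

    old-spanned : ∀ s → sumCols N (c s ++ ⊥) ≡ A s ∷ʳ false
    old-spanned s = begin
      sumCols N (c s ++ ⊥)                          ≡⟨ sumCols-N (c s) ⊥ ⟩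
      sumCols A (c s ⊕ push x ⊥) ∷ʳ parity (⊥ {m})
        ≡⟨ cong₂ (λ V p → sumCols A (c s ⊕ V) ∷ʳ p) (push-⊥ x) (parity-⊥ m) ⟩
      sumCols A (c s ⊕ ⊥) ∷ʳ false                  ≡⟨ cong (λ V → sumCols A V ∷ʳ false) (⊕-identityʳ (c s)) ⟩
      sumCols A (c s) ∷ʳ false                      ≡⟨ cong (_∷ʳ false) (c-sum s) ⟩
      A s ∷ʳ false                                  ∎
      where open ≡-Reasoning

    new-spanned : ∀ i → sumCols N ((c (x i) ⊕ c (x γ)) ++ ⁅ γ ⁆) ≡ A (x i) ∷ʳ true
    new-spanned i = trans (sumCols-N _ ⁅ γ ⁆) (cong₂ _∷ʳ_ top (parity-⁅⁆ γ))
      where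
      open ≡-Reasoning
      top : sumCols A ((c (x i) ⊕ c (x γ)) ⊕ push x ⁅ γ ⁆) ≡ A (x i)
      top = begin
        sumCols A ((c (x i) ⊕ c (x γ)) ⊕ push x ⁅ γ ⁆)
          ≡⟨ trans (sumCols-⊕ A _ _) (cong₂ _⊕_ (sumCols-⊕ A _ _) (sumCols-push A x ⁅ γ ⁆)) ⟩
        (sumCols A (c (x i)) ⊕ sumCols A (c (x γ))) ⊕ sumCols (λ j → A (x j)) ⁅ γ ⁆
          ≡⟨ cong₂ _⊕_ (cong₂ _⊕_ (c-sum (x i)) (c-sum (x γ))) (sumCols-⁅⁆ (λ j → A (x j)) γ) ⟩
        (A (x i) ⊕ A (x γ)) ⊕ A (x γ)           ≡⟨ ⊕-assoc (A (x i)) _ _ ⟩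
        A (x i) ⊕ (A (x γ) ⊕ A (x γ))           ≡⟨ cong (A (x i) ⊕_) (⊕-self _) ⟩
        A (x i) ⊕ 0v                            ≡⟨ ⊕-identityʳ _ ⟩
        A (x i)                                 ∎

    coef : Fin (n + m) → Subset (n + m)
    coef j with splitAt n j
    ... | inj₁ s = c s ++ ⊥
    ... | inj₂ i = (c (x i) ⊕ c (x γ)) ++ ⁅ γ ⁆

    spans : ∀ {U} → Spans N (U0 ++ ⁅ γ ⁆) N U coef
    spans {_} {j} _ with splitAt n j
    ... | inj₁ s = ++-⊆⁺ (c⊆ s) (⊆-min _) , old-spanned s
    ... | inj₂ i = ++-⊆⁺ (⊕-⊆ (c⊆ (x i)) (c⊆ (x γ))) ⊆-refl , new-spanned i

  rank-N-≤ : Fin m → rank N ⊤ ≤ suc (rank A ⊤)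
  rank-N-≤ γ with rank-basis A ⊤
  ... | U0 , _ , indU0 , maximal = rank-≤ N ⊤ λ U _ indU → begin
    ∣ U ∣              ≤⟨ steinitz N (U0 ++ ⁅ γ ⁆) N U coef indU spans ⟩
    ∣ U0 ++ ⁅ γ ⁆ ∣    ≡⟨ ∣++∣ U0 ⁅ γ ⁆ ⟩
    ∣ U0 ∣ + ∣ ⁅ γ ⁆ ∣ ≡⟨ cong₂ _+_ (sym maximal) (∣⁅x⁆∣≡1 γ) ⟩
    rank A ⊤ + 1       ≡⟨ +-comm _ 1 ⟩
    suc (rank A ⊤)     ∎
    where
    open Spanning γ indU0 maximal
    open ≤-Reasoning

  rank-N-> : Fin m → rank A ⊤ < rank N ⊤
  rank-N-> γ = ≤-trans (rank-N->-M ⊤ {⊤} {γ} ∈⊤) (≤-reflexive (cong (rank N) (⊤++⊤ n m)))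

  rank-N-S : rank N (⊤ {n} ++ ⊥ {m}) ≤ rank A ⊤
  rank-N-S = rank-≤ N _ bounded
    where
    bounded : ∀ U → U ⊆ ⊤ {n} ++ ⊥ {m} → Indep N U → ∣ U ∣ ≤ rank A ⊤
    bounded U U⊆ indU with split {n} {m} U
    ... | US , UG , refl with ⊆⊥⇒≡⊥ {V = UG} (proj₂ (++-⊆⁻ {VS = US} {⊤} U⊆))
    ...   | refl = ≤-trans (≤-reflexive (trans (∣++∣ US ⊥) (trans (cong (∣ US ∣ +_) (∣⊥∣≡0 m)) (+-identityʳ _))))
                           (rank-≥ A ⊤ (⊆-max US) (indep-N-S⁻ indU))

connected-bound : ∀ {r n} (A : Matrix r n) {k} → KConnected A k → ∀ {i} → 1 ≤ i → i < k →
  (P : Subset n) → i ≤ ∣ P ∣ → i ≤ ∣ ∁ P ∣ → rank A ⊤ + i ≤ rank A P + rank A (∁ P)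
connected-bound A kc {suc i} 1≤i i<k P large large′
  with rank A P + rank A (∁ P) ≤? rank A ⊤ + i
... | yes sep = ⊥-elim (kc (suc i) 1≤i i<k P (large , large′ , sep))
... | no ¬sep = ≤-trans (≤-reflexive (+-suc (rank A ⊤) i)) (≰⇒> ¬sep)

Indep? : ∀ {r n} (A : Matrix r n) U → Dec (Indep A U)
Indep? A U with independentᵇ A U in e
... | true = yes (independentᵇ⇒Indep A U e)
... | false = no λ ind → true≢false (trans (sym (Indep⇒independentᵇ A U ind)) e)

-- A k-connected matroid has no small circuits: a set Z with |Z| < k whose
-- complement is at least as large is independent (otherwise it would be a
-- |Z|-separation).
small-independent : ∀ {r n} (A : Matrix r n) {k} → KConnected A k → (Z : Subset n) →
  ∣ Z ∣ < k → ∣ Z ∣ ≤ ∣ ∁ Z ∣ → Indep A Z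
small-independent A kc Z small large with Indep? A Z
... | yes ind = ind
... | no dep = ⊥-elim (<-irrefl refl (begin-strict
  rank A ⊤ + ∣ Z ∣              ≤⟨ connected-bound A kc nonempty small Z ≤-refl large ⟩
  rank A Z + rank A (∁ Z)       <⟨ +-monoˡ-< (rank A (∁ Z)) (rank-dependent A Z dep) ⟩
  ∣ Z ∣ + rank A (∁ Z)          ≤⟨ +-monoʳ-≤ ∣ Z ∣ (rank-mono A (⊆-max (∁ Z))) ⟩
  ∣ Z ∣ + rank A ⊤              ≡⟨ +-comm ∣ Z ∣ _ ⟩
  rank A ⊤ + ∣ Z ∣              ∎))
  where
  open ≤-Reasoning
  nonempty : 1 ≤ ∣ Z ∣
  nonempty = ≤-trans (s≤s z≤n) (rank-dependent A Z dep)

-- In the Γ-extension of a 4-connected M with at least 6 elements, one old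
-- and two new elements are always independent: with Y = {s} ∪ YG, the set
-- Z = {s} ∪ x(YG) has at most 3 elements, hence is independent in M.
rank-N-three : ∀ {r n m} (A : Matrix r n) (x : Fin m → Fin n) → Injective _≡_ _≡_ x →
  KConnected A 4 → 6 ≤ n → ∀ YS YG → ∣ YS ∣ ≡ 1 → ∣ YG ∣ ≡ 2 → 3 ≤ rank (ΓExt A x) (YS ++ YG)
rank-N-three {n = n} A x inj kc 6≤n YS YG one two with ∣p∣≡1⇒⁅⁆ YS one
... | s , refl = begin
  3                        ≡⟨ cong₂ _+_ one two ⟨
  ∣ ⁅ s ⁆ ∣ + ∣ YG ∣       ≡⟨ ∣++∣ ⁅ s ⁆ YG ⟨
  ∣ ⁅ s ⁆ ++ YG ∣          ≤⟨ rank-≥ N _ ⊆-refl (indep-N-image indZ (p⊆p∪q _) YG↦Z odd) ⟩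
  rank N (⁅ s ⁆ ++ YG)     ∎
  where
  open ≤-Reasoning
  open Extension A x
  Z : Subset n
  Z = ⁅ s ⁆ ∪ push x YG
  ∣Z∣≤3 : ∣ Z ∣ ≤ 3
  ∣Z∣≤3 = ≤-trans (∣p∪q∣≤ ⁅ s ⁆ _) (+-mono-≤ (≤-reflexive one) (≤-trans (∣push∣≤ x YG) (≤-reflexive two)))
  indZ : Indep A Z
  indZ = small-independent A kc Z (s≤s ∣Z∣≤3) (begin
    ∣ Z ∣       ≤⟨ ∣Z∣≤3 ⟩
    6 ∸ 3       ≤⟨ ∸-mono 6≤n ∣Z∣≤3 ⟩
    n ∸ ∣ Z ∣   ≡⟨ ∣∁p∣≡n∸∣p∣ Z ⟨
    ∣ ∁ Z ∣     ∎)
  YG↦Z : ∀ {i} → i ∈ YG → x i ∈ Z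
  YG↦Z i∈ = q⊆p∪q ⁅ s ⁆ _ (∈-push x inj i∈)
  odd : ∀ V → V ⊆ YG → parity V ≡ false → push x V ⊆ ⁅ s ⁆ → V ≡ ⊥
  odd V _ even push⊆ = push-⊆⁅⁆-even x inj push⊆ even

-- The counting argument
--
-- A partition of E(N) into Y and E(N) − Y is described by numbers only;
-- the inequalities established above are all the argument needs.

-- One side Y = YS ++ YG: a = |YS|, p = |YG|, rM = r_M(YS), rN = r_N(Y).
record Side (k : ℕ) : Set where
  field
    a p rM rN : ℕ
    rM≤a  : rM ≤ a
    rM≤rN : rM ≤ rN
    rM<rN : 1 ≤ p → rM < rN
    p≤rN  : p ≤ rN
    three : k ≡ 4 → a ≡ 1 → p ≡ 2 → 3 ≤ rN
open Side

-- Two sides S, T of a partition of E(N), where M is k-connected of rank R,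
-- has at least 2(k − 1) elements, and |Γ| ≥ k.
record Partition (k R : ℕ) (S T : Side k) : Set where
  field
    many-new  : k ≤ p S + p T
    many-old  : 2 * (k ∸ 1) ≤ a S + a T
    all-in-T  : a S ≡ 0 → R ≤ rM T
    all-in-S  : a T ≡ 0 → R ≤ rM S
    connected : ∀ i → 1 ≤ i → i < k → i ≤ a S → i ≤ a T → R + i ≤ rM S + rM T
open Partition

flip : ∀ {k R S T} → Partition k R S T → Partition k R T S
flip {S = S} {T} P = record
  { many-new  = ≤-trans (many-new P) (≤-reflexive (+-comm (p S) (p T)))
  ; many-old  = ≤-trans (many-old P) (≤-reflexive (+-comm (a S) (a T)))
  ; all-in-T  = all-in-S P
  ; all-in-S  = all-in-T P
  ; connected = λ i 1≤i i<k i≤aT i≤aS →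
      ≤-trans (connected P i 1≤i i<k i≤aS i≤aT) (≤-reflexive (+-comm (rM S) (rM T)))
  }

rank-sum : ∀ {k R S T} → Partition k R S T → 2 ≤ k → R ≤ rM S + rM T
rank-sum {R = R} {S} {T} P 2≤k with a S ≟ 0 | a T ≟ 0
... | yes aS≡0 | _ = ≤-trans (all-in-T P aS≡0) (m≤n+m (rM T) (rM S))
... | no _ | yes aT≡0 = ≤-trans (all-in-S P aT≡0) (m≤m+n (rM S) (rM T))
... | no aS≢0 | no aT≢0 = ≤-trans (m≤m+n R 1) (connected P 1 ≤-refl 2≤k (n≢0⇒n>0 aS≢0) (n≢0⇒n>0 aT≢0))

connected₀ : ∀ {k R S T} → Partition k R S T → 2 ≤ k →
  ∀ i → i < k → i ≤ a S → i ≤ a T → R + i ≤ rM S + rM T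
connected₀ {R = R} P 2≤k zero _ _ _ = ≤-trans (≤-reflexive (+-identityʳ R)) (rank-sum P 2≤k)
connected₀ P 2≤k (suc i) i<k i≤aS i≤aT = connected P (suc i) (s≤s z≤n) i<k i≤aS i≤aT

rank-opposite : ∀ {k R S T} → Partition k R S T → a S < k → a S ≤ a T → R ≤ rM T
rank-opposite {R = R} {S} {T} P aS<k aS≤aT with a S in e
... | zero = all-in-T P e
... | suc a′ = +-cancelˡ-≤ (suc a′) _ _ (begin
  suc a′ + R        ≡⟨ +-comm (suc a′) _ ⟩
  R + suc a′        ≤⟨ connected P (suc a′) (s≤s z≤n) aS<k (≤-reflexive (sym e)) aS≤aT ⟩
  rM S + rM T       ≤⟨ +-monoˡ-≤ (rM T) (≤-trans (rM≤a S) (≤-reflexive e)) ⟩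
  suc a′ + rM T     ∎)
  where open ≤-Reasoning

pinned : ∀ {a j k} → 2 + suc a ≤ j → j < k → k ≤ 4 → a ≡ 0 × j ≡ 3 × k ≡ 4
pinned {a} {j} {k} a+3≤j j<k k≤4 = a≡0 , ≤-antisym j≤3 3≤j , ≤-antisym k≤4 (≤-trans (s≤s 3≤j) j<k)
  where
  j≤3 : j ≤ 3
  j≤3 = s≤s⁻¹ (≤-trans j<k k≤4)
  3≤j : 3 ≤ j
  3≤j = ≤-trans (s≤s (s≤s (s≤s z≤n))) a+3≤j
  a≡0 : a ≡ 0
  a≡0 = n≤0⇒n≡0 (+-cancelˡ-≤ 3 a 0 (≤-trans a+3≤j j≤3))

rank-small-side : ∀ {k j} (S : Side k) → 2 + a S ≤ j → j ≤ a S + p S → j < k → k ≤ 4 → j ≤ rN S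
rank-small-side {k} {j} S a+2≤j j≤size j<k k≤4 with a S in e
... | zero = ≤-trans j≤size (p≤rN S)
... | suc a′ with pinned a+2≤j j<k k≤4
...   | refl , refl , refl with p S ≟ 2
...     | yes p≡2 = three S refl e p≡2
...     | no p≢2 = ≤-trans (≤∧≢⇒< 2≤p (λ e′ → p≢2 (sym e′))) (p≤rN S)
  where
  2≤p : 2 ≤ p S
  2≤p = s≤s⁻¹ j≤size

drop-zero : ∀ {j a p} → j ≤ a + p → p ≡ 0 → j ≤ a
drop-zero j≤ refl = ≤-trans j≤ (≤-reflexive (+-identityʳ _))

swap-sides : ∀ {k j} {S T : Side k} → j ≤ rN T + rN S → j ≤ rN S + rN T
swap-sides {S = S} {T} j≤ = ≤-trans j≤ (≤-reflexive (+-comm (rN T) (rN S)))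

all-new-in : ∀ {k R} {S T : Side k} → Partition k R S T → p T ≡ 0 → k ≤ p S
all-new-in P pT≡0 = drop-zero (many-new P) pT≡0

one-sided : ∀ {k R j} {S T : Side k} → Partition k R S T → p T ≡ 0 → 1 ≤ j → j < k → j ≤ a T →
  R + suc j ≤ rN S + rN T
one-sided {k} {R} {j} {S} {T} P pT≡0 1≤j j<k j≤aT with j ≤? a S
... | yes j≤aS = begin
  R + suc j          ≡⟨ +-suc R j ⟩
  suc (R + j)        ≤⟨ s≤s (connected P j 1≤j j<k j≤aS j≤aT) ⟩
  suc (rM S + rM T)  ≤⟨ +-mono-≤ (rM<rN S (≤-trans (≤-trans (s≤s z≤n) j<k) k≤pS)) (rM≤rN T) ⟩
  rN S + rN T        ∎
  where
  open ≤-Reasoning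
  k≤pS = all-new-in P pT≡0
... | no j≰aS = begin
  R + suc j          ≡⟨ +-comm R (suc j) ⟩
  suc j + R          ≤⟨ +-mono-≤ (≤-trans j<k (≤-trans k≤pS (p≤rN S)))
                                 (≤-trans (rank-opposite P (<-trans aS<j j<k) (≤-trans (<⇒≤ aS<j) j≤aT)) (rM≤rN T)) ⟩
  rN S + rN T        ∎
  where
  open ≤-Reasoning
  aS<j : a S < j
  aS<j = ≰⇒> j≰aS
  k≤pS = all-new-in P pT≡0

small-side : ∀ {k R j} {S T : Side k} → Partition k R S T → k ≤ 4 → 1 ≤ p T →
  2 + a S ≤ j → j < k → j ≤ a S + p S → R + suc j ≤ rN S + rN T
small-side {k} {R} {j} {S} {T} P k≤4 pT≥1 a+2≤j j<k j≤size = begin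
  R + suc j       ≡⟨ +-suc R j ⟩
  suc (R + j)     ≡⟨ cong suc (+-comm R j) ⟩
  suc (j + R)     ≡⟨ +-suc j R ⟨
  j + suc R       ≤⟨ +-mono-≤ (rank-small-side S a+2≤j j≤size j<k k≤4)
                              (≤-trans (s≤s (rank-opposite P aS<k aS≤aT)) (rM<rN T pT≥1)) ⟩
  rN S + rN T     ∎
  where
  open ≤-Reasoning
  aS<k : a S < k
  aS<k = ≤-trans (≤-trans (n≤1+n _) a+2≤j) (<⇒≤ j<k)
  -- with a S ≥ 1 we are in the case k = 4, a S = 1, so |S ∪ T| ≥ 6 gives a T ≥ 5
  aS≤aT : a S ≤ a T
  aS≤aT with a S in e
  ... | zero = z≤n
  ... | suc a′ with pinned a+2≤j j<k k≤4
  ...   | refl , refl , refl =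
    +-cancelˡ-≤ 1 1 (a T) (≤-trans (s≤s (s≤s z≤n)) (subst (λ aS → 6 ≤ aS + a T) e (many-old P)))

two-sided : ∀ {k R i} {S T : Side k} → Partition k R S T → 2 ≤ k → k ≤ 4 → 1 ≤ p S → 1 ≤ p T →
  suc i < k → suc i ≤ a S + p S → suc i ≤ a T + p T → R + suc (suc i) ≤ rN S + rN T
two-sided {k} {R} {i} {S} {T} P 2≤k k≤4 pS≥1 pT≥1 j<k jS jT with i ≤? a S | i ≤? a T
... | yes i≤aS | yes i≤aT = begin
  R + suc (suc i)          ≡⟨ trans (+-suc R (suc i)) (cong suc (+-suc R i)) ⟩
  suc (suc (R + i))        ≤⟨ s≤s (s≤s (connected₀ P 2≤k i (<-trans (n<1+n i) j<k) i≤aS i≤aT)) ⟩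
  suc (suc (rM S + rM T))  ≡⟨ cong suc (+-suc (rM S) (rM T)) ⟨
  suc (rM S) + suc (rM T)  ≤⟨ +-mono-≤ (rM<rN S pS≥1) (rM<rN T pT≥1) ⟩
  rN S + rN T              ∎
  where open ≤-Reasoning
... | no i≰aS | _ = small-side P k≤4 pT≥1 (s≤s (≰⇒> i≰aS)) j<k jS
... | yes _ | no i≰aT = swap-sides {S = S} {T} (small-side (flip P) k≤4 pS≥1 (s≤s (≰⇒> i≰aT)) j<k jT)

lower-bound : ∀ {k R j} {S T : Side k} → Partition k R S T → 2 ≤ k → k ≤ 4 → 1 ≤ j → j < k →
  j ≤ a S + p S → j ≤ a T + p T → R + suc j ≤ rN S + rN T
lower-bound {S = S} {T} P 2≤k k≤4 1≤j j<k jS jT with p T ≟ 0 | p S ≟ 0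
... | yes pT≡0 | _ = one-sided P pT≡0 1≤j j<k (drop-zero jT pT≡0)
... | no _ | yes pS≡0 = swap-sides {S = S} {T} (one-sided (flip P) pS≡0 1≤j j<k (drop-zero jS pS≡0))
... | no pT≢0 | no pS≢0 with 1≤j
...   | s≤s _ = two-sided P 2≤k k≤4 (n≢0⇒n>0 pS≢0) (n≢0⇒n>0 pT≢0) j<k jS jT

-- Sufficiency: if k ≤ |X| and k ≤ 4 then N is k-connected

module Sufficiency {r n m} (A : Matrix r n) (x : Fin m → Fin n) (indX : Indep A (image x))
                   (inj : Injective _≡_ _≡_ x) {k} (kc : KConnected A k) (many-old : 2 * (k ∸ 1) ≤ n) where

  open Extension A x

  side : Subset n → Subset m → Side k
  side YS YG = record
    { a = ∣ YS ∣ ; p = ∣ YG ∣ ; rM = rank A YS ; rN = rank N (YS ++ YG)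
    ; rM≤a  = rank-≤-size A YS
    ; rM≤rN = rank-N-≥-M YS YG
    ; rM<rN = λ 1≤p → rank-N->-M YS (proj₂ (1≤∣p∣⇒∈ YG 1≤p))
    ; p≤rN  = rank-N-≥-Γ indX inj YS YG
    ; three = λ k≡4 → rank-N-three A x inj (subst (KConnected A) k≡4 kc)
                        (subst (λ k → 2 * (k ∸ 1) ≤ n) k≡4 many-old) YS YG
    }

  partition : k ≤ m → ∀ PS PG → Partition k (rank A ⊤) (side PS PG) (side (∁ PS) (∁ PG))
  partition k≤m PS PG = record
    { many-new  = ≤-trans k≤m (≤-reflexive (sym (∣p∣+∣∁p∣ PG)))
    ; many-old  = ≤-trans many-old (≤-reflexive (sym (∣p∣+∣∁p∣ PS)))
    ; all-in-T  = λ empty → rank-mono A λ {y} _ → x∉p⇒x∈∁p λ y∈ → ∉⊥ (subst (y ∈_) (∣p∣≡0⇒≡⊥ PS empty) y∈)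
    ; all-in-S  = λ empty → rank-mono A λ {y} _ → x∉∁p⇒x∈p λ y∈ → ∉⊥ (subst (y ∈_) (∣p∣≡0⇒≡⊥ (∁ PS) empty) y∈)
    ; connected = λ i 1≤i i<k i≤a i≤a′ → connected-bound A kc 1≤i i<k PS i≤a i≤a′
    }

  -- A j-separation (PS ++ PG, complement) would have
  -- r(M) + j + 1 ≤ r_N(P) + r_N(E − P) ≤ r(N) + j − 1 ≤ r(M) + j.
  no-separation : 2 ≤ k → k ≤ m → k ≤ 4 → Fin m → KConnected N k
  no-separation 2≤k k≤m k≤4 γ (suc j) 1≤j j<k P (large , large′ , sep) with split {n} {m} P
  ... | PS , PG , refl = <-irrefl refl (begin-strict
    R + suc j                                     <⟨ +-monoʳ-< R (n<1+n (suc j)) ⟩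
    R + suc (suc j)                               ≤⟨ lower-bound (partition k≤m PS PG) 2≤k k≤4 1≤j j<k sizeS sizeT ⟩
    rank N (PS ++ PG) + rank N (∁ PS ++ ∁ PG)     ≡⟨ cong (λ Q → rank N (PS ++ PG) + rank N Q) (∁-++ PS PG) ⟨
    rank N (PS ++ PG) + rank N (∁ (PS ++ PG))     ≤⟨ sep ⟩
    rank N ⊤ + j                                  ≤⟨ +-monoˡ-≤ j (rank-N-≤ γ) ⟩
    suc R + j                                     ≡⟨ +-suc R j ⟨
    R + suc j                                     ∎)
    where
    open ≤-Reasoning
    R = rank A ⊤
    sizeS : suc j ≤ ∣ PS ∣ + ∣ PG ∣
    sizeS = subst (suc j ≤_) (∣++∣ PS PG) large
    sizeT : suc j ≤ ∣ ∁ PS ∣ + ∣ ∁ PG ∣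
    sizeT = subst (suc j ≤_) (trans (cong ∣_∣ (∁-++ PS PG)) (∣++∣ (∁ PS) (∁ PG))) large′

-- Necessity

k≤2[k∸1] : ∀ k → 2 ≤ k → k ≤ 2 * (k ∸ 1)
k≤2[k∸1] (suc zero) (s≤s ())
k≤2[k∸1] (suc (suc k)) _ = +-mono-≤ (s≤s z≤n) (≤-reflexive (sym (+-identityʳ (suc k))))

even-pair : ∀ {m} → 2 ≤ m → Σ (Subset m) λ V → ∣ V ∣ ≡ 2 × parity V ≡ false × V ≢ ⊥
even-pair {suc zero} (s≤s ())
even-pair {suc (suc m)} _ =
  true ∷ true ∷ ⊥ , cong (2 +_) (∣⊥∣≡0 m) , cong (λ b → true xor (true xor b)) (parity-⊥ m) , λ ()

module Necessity {r n m} (A : Matrix r n) (x : Fin m → Fin n) where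

  open Extension A x

  -- If |Γ| = m < k, then (Γ, S) is an m-separation of N:
  -- r(Γ) + r(S) ≤ m + r(M) ≤ r(N) + m − 1.
  many-new-elements : ∀ {k} → KConnected N k → 2 ≤ k → 2 * (k ∸ 1) ≤ n → 1 ≤ m → k ≤ m
  many-new-elements {k} kcN 2≤k many-old 1≤m with k ≤? m
  ... | yes k≤m = k≤m
  ... | no k≰m = ⊥-elim (kcN m 1≤m (≰⇒> k≰m) Γ (large , large′ , sep))
    where
    Γ = ⊥ {n} ++ ⊤ {m}
    ∁Γ : ∁ Γ ≡ ⊤ {n} ++ ⊥ {m}
    ∁Γ = trans (∁-++ (⊥ {n}) ⊤) (cong₂ _++_ (∁⊥≡⊤ {n}) (∁⊤≡⊥ {m}))
    ∣Γ∣ : ∣ Γ ∣ ≡ m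
    ∣Γ∣ = trans (∣++∣ (⊥ {n}) ⊤) (cong₂ _+_ (∣⊥∣≡0 n) (∣⊤∣≡n m))
    large : m ≤ ∣ Γ ∣
    large = ≤-reflexive (sym ∣Γ∣)
    large′ : m ≤ ∣ ∁ Γ ∣
    large′ = begin
      m                ≤⟨ <⇒≤ (≰⇒> k≰m) ⟩
      k                ≤⟨ k≤2[k∸1] k 2≤k ⟩
      2 * (k ∸ 1)      ≤⟨ many-old ⟩
      n                ≡⟨ trans (cong₂ _+_ (∣⊤∣≡n n) (∣⊥∣≡0 m)) (+-identityʳ n) ⟨
      ∣ ⊤ {n} ∣ + ∣ ⊥ {m} ∣ ≡⟨ ∣++∣ (⊤ {n}) (⊥ {m}) ⟨
      ∣ ⊤ {n} ++ ⊥ {m} ∣ ≡⟨ cong ∣_∣ ∁Γ ⟨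
      ∣ ∁ Γ ∣          ∎
      where open ≤-Reasoning
    sep : rank N Γ + rank N (∁ Γ) ≤ rank N ⊤ + (m ∸ 1)
    sep = begin
      rank N Γ + rank N (∁ Γ)      ≤⟨ +-mono-≤ (≤-trans (rank-≤-size N Γ) (≤-reflexive ∣Γ∣))
                                               (≤-trans (≤-reflexive (cong (rank N) ∁Γ)) rank-N-S) ⟩
      m + rank A ⊤                 ≡⟨ cong (_+ rank A ⊤) (m+[n∸m]≡n 1≤m) ⟨
      suc (m ∸ 1) + rank A ⊤       ≡⟨ +-comm (suc (m ∸ 1)) _ ⟩
      rank A ⊤ + suc (m ∸ 1)       ≡⟨ +-suc (rank A ⊤) (m ∸ 1) ⟩
      suc (rank A ⊤) + (m ∸ 1)     ≤⟨ +-monoˡ-≤ (m ∸ 1) (rank-N-> (Fin.fromℕ< 1≤m)) ⟩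
      rank N ⊤ + (m ∸ 1)           ∎
      where open ≤-Reasoning

  -- For two new elements, {γ, γ′} ∪ {x γ, x γ′} is dependent in N, because
  -- its columns sum to zero; so N, having at least 8 elements, is not
  -- 5-connected.
  at-most-four : ∀ {k} → KConnected N k → k ≤ m → 2 * (k ∸ 1) ≤ n → k ≤ 4
  at-most-four {k} kcN k≤m many-old with k ≤? 4
  ... | yes k≤4 = k≤4
  ... | no k≰4 with even-pair (≤-trans (s≤s (s≤s z≤n)) (≤-trans (≰⇒> k≰4) k≤m))
  ...   | V , ∣V∣≡2 , even , V≢⊥ = ⊥-elim (V≢⊥ (++-injectiveʳ (push x V) ⊥ Z≡⊥))
    where
    Z : Subset (n + m)
    Z = push x V ++ V
    ∣Z∣≤4 : ∣ Z ∣ ≤ 4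
    ∣Z∣≤4 = ≤-trans (≤-reflexive (∣++∣ (push x V) V))
                    (+-mono-≤ (≤-trans (∣push∣≤ x V) (≤-reflexive ∣V∣≡2)) (≤-reflexive ∣V∣≡2))
    8≤n : 8 ≤ n
    8≤n = ≤-trans (*-monoʳ-≤ 2 (∸-monoˡ-≤ 1 (≰⇒> k≰4))) many-old
    complement-large : ∣ Z ∣ ≤ ∣ ∁ Z ∣
    complement-large = begin
      ∣ Z ∣              ≤⟨ ∣Z∣≤4 ⟩
      8 ∸ 4              ≤⟨ ∸-mono (≤-trans 8≤n (m≤m+n n m)) ∣Z∣≤4 ⟩
      (n + m) ∸ ∣ Z ∣    ≡⟨ ∣∁p∣≡n∸∣p∣ Z ⟨
      ∣ ∁ Z ∣            ∎
      where open ≤-Reasoning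
    vanishes : sumCols N Z ≡ 0v
    vanishes = begin
      sumCols N Z                                   ≡⟨ sumCols-N (push x V) V ⟩
      sumCols A (push x V ⊕ push x V) ∷ʳ parity V   ≡⟨ cong₂ (λ W b → sumCols A W ∷ʳ b) (⊕-self (push x V)) even ⟩
      sumCols A ⊥ ∷ʳ false                          ≡⟨ cong (_∷ʳ false) (sumCols-⊥ A) ⟩
      0v ∷ʳ false                                   ≡⟨ 0v-∷ʳ ⟩
      0v                                            ∎
      where open ≡-Reasoning
    Z≡⊥ : Z ≡ ⊥ {n} ++ ⊥ {m}
    Z≡⊥ = trans (small-independent N kcN Z (≤-trans (s≤s ∣Z∣≤4) (≰⇒> k≰4)) complement-large Z ⊆-refl vanishes)
                (sym (⊥++⊥ n m))

theorem2p6 : (k r n m : ℕ) (A : Matrix r n) (x : Fin m → Fin n) →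
    2 ≤ k → KConnected A k → 2 * (k ∸ 1) ≤ n →
    Injective _≡_ _≡_ x → 1 ≤ m → Independent A (image x) →
    (KConnected (ΓExt A x) k ⇔ (k ≤ m × (2 ≤ k × k ≤ 4)))
theorem2p6 k r n m A x 2≤k kc many-old inj 1≤m indep = mk⇔ necessary sufficient
  where
  open Necessity A x
  open Sufficiency A x (Independent⇒Indep A (image x) indep) inj kc many-old
  necessary : KConnected (ΓExt A x) k → k ≤ m × (2 ≤ k × k ≤ 4)
  necessary kcN = k≤m , 2≤k , at-most-four kcN k≤m many-old
    where
    k≤m : k ≤ m
    k≤m = many-new-elements kcN 2≤k many-old 1≤m
  sufficient : k ≤ m × (2 ≤ k × k ≤ 4) → KConnected (ΓExt A x) k
  sufficient (k≤m , _ , k≤4) = no-separation 2≤k k≤m k≤4 (Fin.fromℕ< 1≤m)
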